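{- Let $K$ be an idempotent, linearly ordered, archimedian, cancellative commutative semiring, $N\geq1$, and let $\Sigma_N$ be the set of $2N+N^2$ commuting indeterminates $\mathsf{c}_i,\mathsf{A}_{ij},\mathsf{b}_j$ ($1\leq i,j\leq N$), $\mathsf{K}=K[\Sigma_N]$, $\mathsf{c}=(\mathsf{c}_i)\in\mathsf{K}^{1\times N}$, $\mathsf{A}=(\mathsf{A}_{ij})\in\mathsf{K}^{N\times N}$, $\mathsf{b}=(\mathsf{b}_j)\in\mathsf{K}^{N\times1}$, and $\mathsf{S}_N=\mathsf{c}(\mathsf{A}X)^*\mathsf{b}=\bigoplus_{k\geq0}(\mathsf{c}\mathsf{A}^k\mathsf{b})X^k\in\mathsf{K}[[X]]$. Then $\mathsf{S}_N$ can be written as $$\mathsf{S}_N=\mathsf{P}\oplus X^{\kappa_1c_1}\Big(\bigoplus_{1\leq i\leq\rho}\mathsf{u}_iX^{\mu_i}(\mathsf{q}_iX^{c_1})^*\Big)$$ with $c_1=N!$, $\kappa_1=\mathcal{O}(N!)$, $\rho=2^{\mathcal{O}(N!)}$, integers $0\leq\mu_i\leq c_1-1$, $\mathsf{u}_i,\mathsf{q}_i\in\mathsf{K}$, $\mathsf{P}\in\mathsf{K}[X]$ of degree smaller than $\kappa_1c_1$, and such that the maximum of the numbers of monomials of the polynomials $\langle\mathsf{P},X^i\rangle$ ($0\leq i<\kappa_1c_1$), $\mathsf{u}_i$ and $\mathsf{q}_i$ ($1\leq i\leq\rho$) is $2^{\mathcal{O}(N!)}$.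
   Context: $K$ is a commutative semiring with addition $\oplus$ (idempotent: $u\oplus u=u$; linearly ordered: $u\leq v\iff u\oplus v=v$ is a linear order; archimedian: $u\lambda^k\geq v\mu^k$ for all $k\ge0$ implies $v=\mathbb{0}$ or $\lambda\geq\mu$; cancellative: $uv=u'v$ implies $v=\mathbb{0}$ or $u=u'$). $K[\Sigma_N]$ is the polynomial semiring; the number of monomials $|\mathsf{p}|$ of $\mathsf{p}\in K[\Sigma_N]$ is the number of distinct monomials with nonzero coefficient in $\mathsf{p}$. For a series $\mathsf{T}$ with zero constant term, $\mathsf{T}^*=\bigoplus_{k\ge0}\mathsf{T}^k$; $\langle\mathsf{P},X^i\rangle$ is the coefficient of $X^i$. The $\mathcal{O}$-bounds are as functions of $N$ only. -}

module Defs where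

import Level
open import Algebra.Bundles using (CommutativeSemiring)
open import Data.Bool using (if_then_else_)
open import Data.Nat as ℕ using (ℕ; zero; suc; _+_; _*_; _<?_)
open import Data.Fin as Fin using (Fin; _↑ˡ_; _↑ʳ_; combine; fromℕ<)
open import Data.Vec using (Vec; replicate; zipWith; tabulate)
open import Data.Vec.Properties using (≡-dec)
open import Data.List using (List; []; _∷_; _++_; map; concatMap; foldr; length; upTo; allFin)
open import Data.List.Membership.Propositional using (_∈_)
open import Data.Product using (Σ; _×_; _,_)
open import Data.Sum using (_⊎_)
open import Relation.Nullary using (¬_; yes; no)
open import Relation.Nullary.Decidable using (⌊_⌋)

-- Number of indeterminates of Σ_N : c_i (N of them), b_j (N), A_ij (N*N).
nVars : ℕ → ℕ
nVars N = N + N + N * N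

cVar : ∀ {N} → Fin N → Fin (nVars N)
cVar {N} i = (i ↑ˡ N) ↑ˡ (N * N)

bVar : ∀ {N} → Fin N → Fin (nVars N)
bVar {N} j = (N ↑ʳ j) ↑ˡ (N * N)

AVar : ∀ {N} → Fin N → Fin N → Fin (nVars N)
AVar {N} i j = (N + N) ↑ʳ combine i j

-- A monomial in the indeterminates Σ_N is its exponent vector.
Mono : ℕ → Set
Mono N = Vec ℕ (nVars N)

unitMono : ∀ {N} → Fin (nVars N) → Mono N
unitMono v = tabulate (λ w → if ⌊ v Fin.≟ w ⌋ then 1 else 0)

module WithK {a ℓ} (K : CommutativeSemiring a ℓ) where
  open CommutativeSemiring K renaming (Carrier to R; _+_ to _⊕_; _*_ to _⊗_)

  _≼_ : R → R → Set ℓ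
  u ≼ v = (u ⊕ v) ≈ v

  pow : R → ℕ → R
  pow u zero = 1#
  pow u (suc k) = u ⊗ pow u k

  Idempotent : Set (a Level.⊔ ℓ)
  Idempotent = ∀ u → (u ⊕ u) ≈ u

  -- (for an idempotent commutative semiring ≼ is automatically a partial
  -- order; "linearly ordered" adds totality)
  LinearlyOrdered : Set (a Level.⊔ ℓ)
  LinearlyOrdered = ∀ u v → u ≼ v ⊎ v ≼ u

  Archimedean : Set (a Level.⊔ ℓ)
  Archimedean = ∀ u v λ' μ → (∀ k → (v ⊗ pow μ k) ≼ (u ⊗ pow λ' k)) → v ≈ 0# ⊎ μ ≼ λ'

  Cancellative : Set (a Level.⊔ ℓ)
  Cancellative = ∀ u u' v → (u ⊗ v) ≈ (u' ⊗ v) → v ≈ 0# ⊎ u ≈ u'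

  module Polys (N : ℕ) where
    MonoN : Set
    MonoN = Mono N

    -- Polynomials of K[Σ_N], as formal finite sums of coefficient·monomial.
    Poly : Set a
    Poly = List (R × MonoN)

    coeff : Poly → MonoN → R
    coeff p m = foldr (λ { (x , m') acc → if ⌊ ≡-dec ℕ._≟_ m' m ⌋ then x ⊕ acc else acc }) 0# p

    zeroP : Poly
    zeroP = []

    _⊕P_ : Poly → Poly → Poly
    p ⊕P q = p ++ q

    _⊗P_ : Poly → Poly → Poly
    p ⊗P q = concatMap (λ { (x , m) → map (λ { (y , m') → (x ⊗ y , zipWith _+_ m m') }) q }) p

    oneP : Poly
    oneP = (1# , replicate _ 0) ∷ []

    powP : Poly → ℕ → Poly
    powP p zero = oneP
    powP p (suc k) = p ⊗P powP p k

    var : Fin (nVars N) → Poly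
    var v = (1# , unitMono {N} v) ∷ []

    sumFin : ∀ n → (Fin n → Poly) → Poly
    sumFin n f = concatMap f (allFin n)

    Apowb : ℕ → Fin N → Poly
    Apowb zero i = var (bVar i)
    Apowb (suc k) i = sumFin N (λ j → var (AVar i j) ⊗P Apowb k j)

    -- ⟨S_N , X^k⟩ = c A^k b
    S : ℕ → Poly
    S k = sumFin N (λ i → var (cVar i) ⊗P Apowb k i)

    -- ⟨P , X^k⟩ for P of degree < d given by its coefficients
    Pcoef : ∀ d → (Fin d → Poly) → ℕ → Poly
    Pcoef d P k with k <? d
    ... | yes k<d = P (fromℕ< k<d)
    ... | no _ = zeroP

    -- ⟨ X^s · u X^μ (q X^c)^* , X^k ⟩ = ⊕_{j ≥ 0, s+μ+jc = k} u q^j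
    -- (only j ≤ k can contribute since c ≥ 1)
    starTerm : ∀ (s c μ : ℕ) → Poly → Poly → ℕ → Poly
    starTerm s c μ u q k =
      concatMap (λ j → if ⌊ (s + μ + j * c) ℕ.≟ k ⌋ then u ⊗P powP q j else zeroP) (upTo (suc k))

    -- ⟨ P ⊕ X^{κ c} (⊕_i u_i X^{μ_i} (q_i X^c)^*) , X^k ⟩
    rhs : ∀ (κ c ρ : ℕ) → (Fin ρ → Fin c) → (Fin ρ → Poly) → (Fin ρ → Poly)
          → (Fin (κ * c) → Poly) → ℕ → Poly
    rhs κ c ρ μ u q P k =
      Pcoef (κ * c) P k ⊕P sumFin ρ (λ i → starTerm (κ * c) c (Fin.toℕ (μ i)) (u i) (q i) k)

    AtMostMonos : ℕ → Poly → Set ℓ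
    AtMostMonos B p =
      Σ (List (MonoN)) λ L → (length L ℕ.≤ B) × (∀ m → ¬ (coeff p m ≈ 0#) → m ∈ L)

module Submission where

open import Defs
open import Level using (Level)
open import Algebra.Bundles using (CommutativeSemiring)
open import Data.Nat using (ℕ; _*_; _^_; _≤_; _!)
open import Data.Fin using (Fin)
open import Data.Product using (Σ; _×_; _,_)

-- Expanding the matrix products, the monomials of ⟨S_N , X^k⟩ = c A^k b
-- are exactly  c_s · A_{s x₁} A_{x₁ x₂} ⋯ A_{x_{k-1} x_k} · b_{x_k}  for the walks
-- s → x₁ → ⋯ → x_k of length k in the complete digraph on N vertices, and every
-- polynomial occurring in the construction has all its coefficients equal to 1.
-- Since K is idempotent, two such polynomials have equal coefficients as soon as
-- they have the same support, so the statement reduces to combinatorics of walks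
-- (idempotency is the only property of K that is used).
--   The key fact is a cycle-pumping lemma (Walks.pumpStep): a walk of length
-- ≥ T = κ·N!, κ = N² + (N+1)², contains N!/ℓ closed walks of a common length ℓ ≤ N
-- (so of total length c = N!) based at visited vertices, whose removal leaves a walk
-- with the same vertex set; conversely closed walks based at visited vertices can
-- always be re-inserted.  Hence for k = T + r + j·c with r < c the monomials of
-- ⟨S_N , X^k⟩ are exactly the products of a monomial of u_{U,T+r} (c_s times a walk
-- of length T + r visiting all of U) with j monomials of q_U (families of closed
-- walks of total length c based in U), U ranging over the 2^N vertex sets.  With P
-- the first T coefficients of S_N this is the decomposition with κ₁ = κ, c₁ = N! and
-- ρ = 2^N·N!.  All exponents occurring are at most D = T + c + 2, which bounds every
-- number of monomials by (D+1)^(2N+N²) ≤ 2^(512·N!).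

module ExponentVectors where
  open import Data.Nat using (_+_)
  open import Data.Nat.Properties using (+-assoc; +-comm; +-identityˡ; +-identityʳ)
  open import Data.Vec using (Vec; zipWith; replicate)
  open import Data.Vec.Properties
    using (zipWith-assoc; zipWith-comm; zipWith-identityˡ; zipWith-identityʳ)
  open import Relation.Binary.PropositionalEquality using (_≡_; sym; trans; cong)

  infixr 6 _+ᵥ_

  _+ᵥ_ : ∀ {n} → Vec ℕ n → Vec ℕ n → Vec ℕ n
  _+ᵥ_ = zipWith _+_

  0ᵥ : ∀ {n} → Vec ℕ n
  0ᵥ = replicate _ 0

  +ᵥ-assoc : ∀ {n} (a b c : Vec ℕ n) → (a +ᵥ b) +ᵥ c ≡ a +ᵥ (b +ᵥ c)
  +ᵥ-assoc = zipWith-assoc +-assoc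

  +ᵥ-comm : ∀ {n} (a b : Vec ℕ n) → a +ᵥ b ≡ b +ᵥ a
  +ᵥ-comm = zipWith-comm +-comm

  +ᵥ-identityˡ : ∀ {n} (a : Vec ℕ n) → 0ᵥ +ᵥ a ≡ a
  +ᵥ-identityˡ = zipWith-identityˡ +-identityˡ

  +ᵥ-identityʳ : ∀ {n} (a : Vec ℕ n) → a +ᵥ 0ᵥ ≡ a
  +ᵥ-identityʳ = zipWith-identityʳ +-identityʳ

  +ᵥ-swap : ∀ {n} (a b c : Vec ℕ n) → a +ᵥ (b +ᵥ c) ≡ b +ᵥ (a +ᵥ c)
  +ᵥ-swap a b c =
    trans (sym (+ᵥ-assoc a b c)) (trans (cong (_+ᵥ c) (+ᵥ-comm a b)) (+ᵥ-assoc b a c))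

module ListFacts where
  open import Data.Nat using (zero; suc; _<_; s≤s; s≤s⁻¹)
  open import Data.Nat.Properties using (<-≤-trans)
  open import Data.List using (List; []; _∷_; _++_; length; filter)
  open import Data.List.Properties using (filter-notAll)
  open import Data.List.Relation.Unary.Any using (Any; here; there)
  open import Data.List.Relation.Unary.All using (all?)
  import Data.List.Relation.Unary.All as All
  open import Data.List.Relation.Unary.All.Properties using (¬All⇒Any¬)
  open import Data.List.Membership.Propositional using (_∈_; _∉_; find)
  open import Data.List.Membership.Propositional.Properties using (∈-∃++; ∈-filter⁺)
  open import Data.Sum using (_⊎_; inj₁; inj₂)
  open import Relation.Nullary using (¬_; yes; no; ¬?)
  open import Relation.Binary.Definitions using (DecidableEquality)
  open import Relation.Binary.PropositionalEquality using (_≡_; refl; sym; cong; subst)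

  splitPrefix : ∀ {A : Set} k (xs : List A) → k ≤ length xs →
    Σ (List A) λ pre → Σ (List A) λ rest → (xs ≡ pre ++ rest) × (length pre ≡ k)
  splitPrefix zero xs _ = [] , xs , refl , refl
  splitPrefix (suc k) (x ∷ xs) (s≤s le) with splitPrefix k xs le
  ... | pre , rest , eq , len = x ∷ pre , rest , cong (x ∷_) eq , cong suc len

  module _ {A : Set} (_≟_ : DecidableEquality A) where
    open import Data.List.Membership.DecPropositional _≟_ using (_∈?_)

    ⊆-or-new : ∀ (xs ys : List A) → (∀ y → y ∈ ys → y ∈ xs) ⊎ (Σ A λ z → z ∈ ys × z ∉ xs)
    ⊆-or-new xs ys with all? (_∈? xs) ys
    ... | yes ys⊆xs = inj₁ (λ y y∈ys → All.lookup ys⊆xs y∈ys)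
    ... | no ¬ys⊆xs = inj₂ (find (¬All⇒Any¬ (_∈? xs) ys ¬ys⊆xs))

    record Repetition (xs : List A) : Set where
      constructor mkRepetition
      field
        before : List A
        repeated : A
        between after : List A
        split : xs ≡ before ++ repeated ∷ (between ++ repeated ∷ after)

    repetition : ∀ (cands xs : List A) → (∀ y → y ∈ xs → y ∈ cands) →
                 length cands < length xs → Repetition xs
    repetition cands (x ∷ xs) xs⊆cands lt with x ∈? xs
    ... | yes x∈xs with ∈-∃++ x∈xs
    ...   | ys , zs , eq = mkRepetition [] x ys zs (cong (x ∷_) eq)
    repetition cands (x ∷ xs) xs⊆cands lt | no x∉xs
      with repetition (filter other? cands) xs fewer⊆ shorter
      where
      other? = λ y → ¬? (y ≟ x)
      fewer⊆ : ∀ y → y ∈ xs → y ∈ filter other? cands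
      fewer⊆ y y∈xs = ∈-filter⁺ other? (xs⊆cands y (there y∈xs)) (λ y≡x → x∉xs (subst (_∈ xs) y≡x y∈xs))
      x-among : ∀ {zs} → x ∈ zs → Any (λ y → ¬ ¬ (y ≡ x)) zs
      x-among (here e) = here (λ k → k (sym e))
      x-among (there q) = there (x-among q)
      shorter : length (filter other? cands) < length xs
      shorter = <-≤-trans (filter-notAll other? cands (x-among (xs⊆cands x (here refl)))) (s≤s⁻¹ lt)
    ... | mkRepetition as v bs cs eq = mkRepetition (x ∷ as) v bs cs (cong (x ∷_) eq)

-- A walk is a start vertex s
-- together with the list xs of the vertices it moves to: its length is length xs and
-- its vertex set is s ∷ xs.
module Walks (N : ℕ) where
  open ExponentVectors
  open ListFacts
  open import Data.Nat using (zero; suc; _+_; _∸_; _<_; z≤n; s≤s; s≤s⁻¹)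
  open import Data.Nat.Properties
  open import Algebra.Properties.CommutativeSemigroup +-commutativeSemigroup
    using () renaming (x∙yz≈y∙xz to +-swap)
  open import Data.Fin.Properties using () renaming (_≟_ to _≟ᵛ_)
  import Data.Fin as Fin
  open import Data.Bool using (true; false; if_then_else_)
  open import Data.Vec using (lookup)
  open import Data.Vec.Properties using (lookup-zipWith; lookup-replicate; lookup∘tabulate)
  open import Relation.Nullary.Decidable using (⌊_⌋)
  open import Data.List using (List; []; _∷_; _++_; length; filter; allFin)
  open import Data.List.Properties using (length-++; ++-assoc; filter-notAll; length-tabulate)
  open import Data.List.Relation.Unary.Any using (Any; here; there)
  open import Data.List.Membership.Propositional using (_∈_; _∉_)
  open import Data.List.Membership.Propositional.Properties
    using (∈-++⁺ˡ; ∈-++⁺ʳ; ∈-++⁻; ∈-filter⁺; ∈-tabulate⁺)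
  open import Data.List.Membership.DecPropositional (_≟ᵛ_ {N}) using (_∈?_)
  open import Data.Sum using (_⊎_; inj₁; inj₂)
  open import Relation.Nullary using (¬_; ¬?; yes; no)
  open import Relation.Binary.PropositionalEquality

  Vertex : Set
  Vertex = Fin N

  monoA : Vertex → Vertex → Mono N
  monoA i j = unitMono {N} (AVar i j)

  monoB : Vertex → Mono N
  monoB j = unitMono {N} (bVar j)

  monoC : Vertex → Mono N
  monoC i = unitMono {N} (cVar i)

  endpoint : Vertex → List Vertex → Vertex
  endpoint s [] = s
  endpoint s (x ∷ xs) = endpoint x xs

  pathMono : Vertex → List Vertex → Mono N
  pathMono s [] = 0ᵥ
  pathMono s (x ∷ xs) = monoA s x +ᵥ pathMono x xs

  walkMono : Vertex → List Vertex → Mono N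
  walkMono s [] = monoB s
  walkMono s (x ∷ xs) = monoA s x +ᵥ walkMono x xs

  endpoint-++ : ∀ s as bs → endpoint s (as ++ bs) ≡ endpoint (endpoint s as) bs
  endpoint-++ s [] bs = refl
  endpoint-++ s (x ∷ as) bs = endpoint-++ x as bs

  endpoint-∈ : ∀ s xs → endpoint s xs ∈ s ∷ xs
  endpoint-∈ s [] = here refl
  endpoint-∈ s (x ∷ xs) = there (endpoint-∈ x xs)

  walkMono-++ : ∀ s as bs → walkMono s (as ++ bs) ≡ pathMono s as +ᵥ walkMono (endpoint s as) bs
  walkMono-++ s [] bs = sym (+ᵥ-identityˡ _)
  walkMono-++ s (x ∷ as) bs =
    trans (cong (monoA s x +ᵥ_) (walkMono-++ x as bs)) (sym (+ᵥ-assoc _ _ _))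

  record Insertion (s : Vertex) (xs : List Vertex) (v : Vertex) (cs : List Vertex) : Set where
    constructor mkInsertion
    field
      walk : List Vertex
      length-walk : length walk ≡ length cs + length xs
      walkMono-walk : walkMono s walk ≡ pathMono v cs +ᵥ walkMono s xs
      keeps : ∀ y → y ∈ s ∷ xs → y ∈ s ∷ walk
      adds : ∀ y → y ∈ s ∷ walk → y ∈ s ∷ xs ⊎ y ∈ cs

  insert : ∀ s xs v cs → v ∈ s ∷ xs → endpoint v cs ≡ v → Insertion s xs v cs
  insert s xs v cs (here refl) closed = mkInsertion (cs ++ xs)
    (length-++ cs)
    (trans (walkMono-++ s cs xs) (cong (λ z → pathMono s cs +ᵥ walkMono z xs) closed))
    keeps adds
    where
    keeps : ∀ y → y ∈ s ∷ xs → y ∈ s ∷ (cs ++ xs)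
    keeps y (here p) = here p
    keeps y (there p) = there (∈-++⁺ʳ cs p)
    adds : ∀ y → y ∈ s ∷ (cs ++ xs) → y ∈ s ∷ xs ⊎ y ∈ cs
    adds y (here p) = inj₁ (here p)
    adds y (there p) with ∈-++⁻ cs p
    ... | inj₁ q = inj₂ q
    ... | inj₂ q = inj₁ (there q)
  insert s (x ∷ xs) v cs (there v∈xs) closed with insert x xs v cs v∈xs closed
  ... | mkInsertion ys len mono keeps adds = mkInsertion (x ∷ ys)
    (trans (cong suc len) (sym (+-suc _ _)))
    (trans (cong (monoA s x +ᵥ_) mono) (+ᵥ-swap _ _ _))
    keeps′ adds′
    where
    keeps′ : ∀ y → y ∈ s ∷ x ∷ xs → y ∈ s ∷ x ∷ ys
    keeps′ y (here q) = here q
    keeps′ y (there q) = there (keeps y q)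
    adds′ : ∀ y → y ∈ s ∷ x ∷ ys → y ∈ s ∷ x ∷ xs ⊎ y ∈ cs
    adds′ y (here q) = inj₁ (here q)
    adds′ y (there q) with adds y q
    ... | inj₁ r = inj₁ (there r)
    ... | inj₂ r = inj₂ r

  length-allFin : length (allFin N) ≡ N
  length-allFin = length-tabulate {n = N} (λ i → i)

  -- A closed walk (base, cycle) of length between 1 and N occurring in the walk (s, xs)
  -- all of whose vertices were visited before it starts (or belong to pre): cutting it
  -- out does not change the vertex set.
  record ShortCycle (pre : List Vertex) (s : Vertex) (xs : List Vertex) : Set where
    constructor mkShortCycle
    field
      before : List Vertex
      base : Vertex
      cycle after : List Vertex
      split : xs ≡ before ++ base ∷ (cycle ++ after)
      closed : endpoint base cycle ≡ base
      nonempty : 1 ≤ length cycle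
      short : length cycle ≤ N
      revisits : ∀ y → y ∈ cycle → y ∈ pre ⊎ y ∈ s ∷ before

  -- N+1 consecutive vertices, all in pre, contain a repetition and hence a short cycle
  cycleInBlock : ∀ pre s blk rest → length blk ≡ suc N → (∀ y → y ∈ blk → y ∈ pre) →
                 ShortCycle pre s (blk ++ rest)
  cycleInBlock pre s blk rest len blk⊆pre
    with repetition _≟ᵛ_ (allFin N) blk (λ y _ → ∈-tabulate⁺ y)
           (subst₂ _<_ (sym length-allFin) (sym len) ≤-refl)
  ... | mkRepetition as v bs cs refl = mkShortCycle as v (bs ++ v ∷ []) (cs ++ rest)
        split (endpoint-++ v bs (v ∷ [])) nonempty short revisits
    where
    split : (as ++ v ∷ (bs ++ v ∷ cs)) ++ rest ≡ as ++ v ∷ ((bs ++ v ∷ []) ++ cs ++ rest)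
    split = trans (++-assoc as _ rest) (cong (λ z → as ++ v ∷ z)
              (trans (++-assoc bs _ rest) (sym (++-assoc bs (v ∷ []) (cs ++ rest)))))
    nonempty : 1 ≤ length (bs ++ v ∷ [])
    nonempty = subst (1 ≤_) (sym (length-++ bs)) (m≤n+m 1 (length bs))
    short : length (bs ++ v ∷ []) ≤ N
    short = s≤s⁻¹ (begin
      suc (length (bs ++ v ∷ []))            ≡⟨ cong suc (length-++ bs) ⟩
      suc (length bs + 1)                    ≤⟨ s≤s (+-monoʳ-≤ (length bs) (s≤s z≤n)) ⟩
      suc (length bs + suc (length cs))      ≤⟨ m≤n+m _ (length as) ⟩
      length as + suc (length bs + suc (length cs))
        ≡⟨ cong (λ z → length as + suc z) (sym (length-++ bs)) ⟩
      length as + suc (length (bs ++ v ∷ cs)) ≡⟨ sym (length-++ as) ⟩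
      length (as ++ v ∷ (bs ++ v ∷ cs))      ≡⟨ len ⟩
      suc N                                  ∎)
      where open ≤-Reasoning
    revisits : ∀ y → y ∈ bs ++ v ∷ [] → y ∈ pre ⊎ y ∈ s ∷ as
    revisits y q with ∈-++⁻ bs q
    ... | inj₁ r = inj₁ (blk⊆pre y (∈-++⁺ʳ as (there (∈-++⁺ˡ r))))
    ... | inj₂ (here refl) = inj₁ (blk⊆pre y (∈-++⁺ʳ as (here refl)))

  afterPrefix : ∀ pre s blk rest → ShortCycle (pre ++ s ∷ blk) (endpoint s blk) rest →
                ShortCycle pre s (blk ++ rest)
  afterPrefix pre s blk rest (mkShortCycle as v cyc tl refl closed nonempty short revisits) =
    mkShortCycle (blk ++ as) v cyc tl (sym (++-assoc blk as _)) closed nonempty short revisits′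
    where
    revisits′ : ∀ y → y ∈ cyc → y ∈ pre ⊎ y ∈ s ∷ (blk ++ as)
    revisits′ y q with revisits y q
    ... | inj₂ (here refl) with endpoint-∈ s blk
    ...   | here e = inj₂ (here e)
    ...   | there r = inj₂ (there (∈-++⁺ˡ r))
    revisits′ y q | inj₂ (there r) = inj₂ (there (∈-++⁺ʳ blk r))
    revisits′ y q | inj₁ r with ∈-++⁻ pre r
    ... | inj₁ r′ = inj₁ r′
    ... | inj₂ (here e) = inj₂ (here e)
    ... | inj₂ (there r′) = inj₂ (there (∈-++⁺ˡ r′))

  fewerUnseen : ∀ pre pre′ unseen z → (∀ y → y ∉ pre → y ∈ unseen) → (∀ y → y ∈ pre → y ∈ pre′) →
                z ∈ unseen → z ∈ pre′ →
                Σ (List Vertex) λ unseen′ → length unseen′ < length unseen × (∀ y → y ∉ pre′ → y ∈ unseen′)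
  fewerUnseen pre pre′ unseen z inv pre⊆pre′ z∈unseen z∈pre′ =
    filter unvisited? unseen ,
    filter-notAll unvisited? unseen (visited z∈unseen) ,
    (λ y y∉pre′ → ∈-filter⁺ unvisited? (inv y (λ y∈pre → y∉pre′ (pre⊆pre′ y y∈pre))) y∉pre′)
    where
    unvisited? = λ y → ¬? (y ∈? pre′)
    visited : ∀ {zs} → z ∈ zs → Any (λ y → ¬ ¬ (y ∈ pre′)) zs
    visited (here refl) = here (λ k → k z∈pre′)
    visited (there q) = there (visited q)

  -- If all vertices outside pre lie in a list of length ≤ n, every walk of length
  -- ≥ (n+1)(N+1) contains a short cycle: its first N+1 vertices either all lie in pre
  -- (use cycleInBlock) or visit a new vertex, and then we recurse on the rest with n-1.
  findShortCycle : ∀ n pre (unseen : List Vertex) → length unseen ≤ n → (∀ y → y ∉ pre → y ∈ unseen) →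
                   ∀ s xs → suc n * suc N ≤ length xs → ShortCycle pre s xs
  findShortCycle n pre unseen lu inv s xs lx
    with splitPrefix (suc N) xs (≤-trans (m≤m+n (suc N) (n * suc N)) lx)
  ... | blk , rest , refl , lb with ⊆-or-new _≟ᵛ_ pre blk
  ...   | inj₁ blk⊆pre = cycleInBlock pre s blk rest lb blk⊆pre
  ...   | inj₂ (z , z∈blk , z∉pre)
    with fewerUnseen pre (pre ++ s ∷ blk) unseen z inv (λ _ → ∈-++⁺ˡ) (inv z z∉pre)
           (∈-++⁺ʳ pre (there z∈blk))
  ...     | unseen′ , shorter , inv′ = newVertex n lu lx
    where
    newVertex : ∀ n → length unseen ≤ n → suc n * suc N ≤ length (blk ++ rest) →
                ShortCycle pre s (blk ++ rest)
    newVertex zero lu _ with ≤-trans shorter lu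
    ... | ()
    newVertex (suc n) lu lx = afterPrefix pre s blk rest
      (findShortCycle n (pre ++ s ∷ blk) unseen′ (s≤s⁻¹ (<-≤-trans shorter lu)) inv′
        (endpoint s blk) rest restLong)
      where
      restLong : suc n * suc N ≤ length rest
      restLong = +-cancelˡ-≤ (suc N) _ _
        (subst (suc N + suc n * suc N ≤_) (trans (length-++ blk) (cong (_+ length rest) lb)) lx)

  -- closed walks of length between 1 and N, the building blocks of the q-polynomials
  record Cycle : Set where
    constructor mkCycle
    field
      base : Vertex
      vertices : List Vertex
      closed : endpoint base vertices ≡ base
      nonempty : 1 ≤ length vertices
      short : length vertices ≤ N

  open Cycle public using (base; vertices; closed)

  cycleLength : Cycle → ℕ
  cycleLength x = length (vertices x)

  cycleMono : Cycle → Mono N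
  cycleMono x = pathMono (base x) (vertices x)

  record CycleRemoval (s : Vertex) (xs : List Vertex) : Set where
    constructor mkCycleRemoval
    field
      walk : List Vertex
      removed : Cycle
      length-walk : length xs ≡ cycleLength removed + length walk
      walkMono-walk : walkMono s xs ≡ cycleMono removed +ᵥ walkMono s walk
      keeps : ∀ y → y ∈ s ∷ xs → y ∈ s ∷ walk
      within : ∀ y → y ∈ s ∷ walk → y ∈ s ∷ xs
      removed⊆ : ∀ y → y ∈ vertices removed → y ∈ s ∷ xs
      base∈ : base removed ∈ s ∷ walk

  removeCycle : ∀ s xs → suc N * suc N ≤ length xs → CycleRemoval s xs
  removeCycle s xs lx
    with findShortCycle N [] (allFin N) (≤-reflexive length-allFin) (λ y _ → ∈-tabulate⁺ y) s xs lx
  ... | mkShortCycle as v cyc tl refl closed nonempty short revisits =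
    mkCycleRemoval (as ++ v ∷ tl) (mkCycle v cyc closed nonempty short)
      lengths monos keeps within removed⊆ (there (∈-++⁺ʳ as (here refl)))
    where
    lengths : length (as ++ v ∷ (cyc ++ tl)) ≡ length cyc + length (as ++ v ∷ tl)
    lengths = begin
      length (as ++ v ∷ (cyc ++ tl))           ≡⟨ length-++ as ⟩
      length as + suc (length (cyc ++ tl))     ≡⟨ cong (λ z → length as + suc z) (length-++ cyc) ⟩
      length as + suc (length cyc + length tl) ≡⟨ cong (length as +_) (sym (+-suc (length cyc) (length tl))) ⟩
      length as + (length cyc + suc (length tl)) ≡⟨ +-swap (length as) (length cyc) _ ⟩
      length cyc + (length as + suc (length tl)) ≡⟨ cong (length cyc +_) (sym (length-++ as)) ⟩
      length cyc + length (as ++ v ∷ tl)       ∎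
      where open ≡-Reasoning
    monos : walkMono s (as ++ v ∷ (cyc ++ tl)) ≡ pathMono v cyc +ᵥ walkMono s (as ++ v ∷ tl)
    monos = begin
      walkMono s (as ++ v ∷ (cyc ++ tl))                           ≡⟨ walkMono-++ s as _ ⟩
      pathMono s as +ᵥ (monoA w v +ᵥ walkMono v (cyc ++ tl))
        ≡⟨ cong (λ z → pathMono s as +ᵥ (monoA w v +ᵥ z)) (walkMono-++ v cyc tl) ⟩
      pathMono s as +ᵥ (monoA w v +ᵥ (pathMono v cyc +ᵥ walkMono (endpoint v cyc) tl))
        ≡⟨ cong (λ z → pathMono s as +ᵥ (monoA w v +ᵥ (pathMono v cyc +ᵥ walkMono z tl))) closed ⟩
      pathMono s as +ᵥ (monoA w v +ᵥ (pathMono v cyc +ᵥ walkMono v tl))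
        ≡⟨ cong (pathMono s as +ᵥ_) (+ᵥ-swap _ _ _) ⟩
      pathMono s as +ᵥ (pathMono v cyc +ᵥ (monoA w v +ᵥ walkMono v tl)) ≡⟨ +ᵥ-swap _ _ _ ⟩
      pathMono v cyc +ᵥ (pathMono s as +ᵥ (monoA w v +ᵥ walkMono v tl))
        ≡⟨ cong (pathMono v cyc +ᵥ_) (sym (walkMono-++ s as (v ∷ tl))) ⟩
      pathMono v cyc +ᵥ walkMono s (as ++ v ∷ tl)                  ∎
      where
      open ≡-Reasoning
      w = endpoint s as
    keeps : ∀ y → y ∈ s ∷ (as ++ v ∷ (cyc ++ tl)) → y ∈ s ∷ (as ++ v ∷ tl)
    keeps y (here e) = here e
    keeps y (there q) with ∈-++⁻ as q
    ... | inj₁ r = there (∈-++⁺ˡ r)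
    ... | inj₂ (here e) = there (∈-++⁺ʳ as (here e))
    ... | inj₂ (there r) with ∈-++⁻ cyc r
    ...   | inj₂ r′ = there (∈-++⁺ʳ as (there r′))
    ...   | inj₁ r′ with revisits y r′
    ...     | inj₁ ()
    ...     | inj₂ (here e) = here e
    ...     | inj₂ (there r″) = there (∈-++⁺ˡ r″)
    within : ∀ y → y ∈ s ∷ (as ++ v ∷ tl) → y ∈ s ∷ (as ++ v ∷ (cyc ++ tl))
    within y (here e) = here e
    within y (there q) with ∈-++⁻ as q
    ... | inj₁ r = there (∈-++⁺ˡ r)
    ... | inj₂ (here e) = there (∈-++⁺ʳ as (here e))
    ... | inj₂ (there r) = there (∈-++⁺ʳ as (there (∈-++⁺ʳ cyc r)))
    removed⊆ : ∀ y → y ∈ cyc → y ∈ s ∷ (as ++ v ∷ (cyc ++ tl))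
    removed⊆ y q = there (∈-++⁺ʳ as (there (∈-++⁺ˡ q)))

  cyclesMono : List Cycle → Mono N
  cyclesMono [] = 0ᵥ
  cyclesMono (x ∷ l) = cycleMono x +ᵥ cyclesMono l

  totalLength : List Cycle → ℕ
  totalLength [] = 0
  totalLength (x ∷ l) = cycleLength x + totalLength l

  cyclesMono-++ : ∀ a b → cyclesMono (a ++ b) ≡ cyclesMono a +ᵥ cyclesMono b
  cyclesMono-++ [] b = sym (+ᵥ-identityˡ _)
  cyclesMono-++ (x ∷ a) b = trans (cong (_ +ᵥ_) (cyclesMono-++ a b)) (sym (+ᵥ-assoc _ _ _))

  totalLength-++ : ∀ a b → totalLength (a ++ b) ≡ totalLength a + totalLength b
  totalLength-++ [] b = refl
  totalLength-++ (x ∷ a) b = trans (cong (_ +_) (totalLength-++ a b)) (sym (+-assoc (cycleLength x) _ _))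

  totalLength-uniform : ∀ ℓ l → (∀ x → x ∈ l → cycleLength x ≡ ℓ) → totalLength l ≡ length l * ℓ
  totalLength-uniform ℓ [] _ = refl
  totalLength-uniform ℓ (x ∷ l) p =
    cong₂ _+_ (p x (here refl)) (totalLength-uniform ℓ l (λ y q → p y (there q)))

  -- Removing m cycles one after the other (each time from a walk still of length
  -- ≥ (N+1)²); the bases of all removed cycles are visited by the remaining walk.
  record CyclesRemoval (s : Vertex) (xs : List Vertex) (m : ℕ) : Set where
    constructor mkCyclesRemoval
    field
      walk : List Vertex
      removed : List Cycle
      count : length removed ≡ m
      length-walk : length xs ≡ totalLength removed + length walk
      walkMono-walk : walkMono s xs ≡ cyclesMono removed +ᵥ walkMono s walk
      keeps : ∀ y → y ∈ s ∷ xs → y ∈ s ∷ walk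
      within : ∀ y → y ∈ s ∷ walk → y ∈ s ∷ xs
      bases∈ : ∀ x → x ∈ removed → base x ∈ s ∷ walk
      removed⊆ : ∀ x → x ∈ removed → ∀ y → y ∈ vertices x → y ∈ s ∷ xs

  removeCycles : ∀ m s xs → m * N + suc N * suc N ≤ length xs → CyclesRemoval s xs m
  removeCycles zero s xs _ =
    mkCyclesRemoval xs [] refl refl (sym (+ᵥ-identityˡ _)) (λ _ q → q) (λ _ q → q) (λ _ ()) (λ _ ())
  removeCycles (suc m) s xs lx with removeCycle s xs (≤-trans (m≤n+m _ (suc m * N)) lx)
  ... | mkCycleRemoval ys x lenx monox keepsx withinx x⊆ basex∈
    with removeCycles m s ys longEnough
    where
    longEnough : m * N + suc N * suc N ≤ length ys
    longEnough = +-cancelˡ-≤ N _ _ (begin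
      N + (m * N + suc N * suc N) ≡⟨ sym (+-assoc N _ _) ⟩
      suc m * N + suc N * suc N   ≤⟨ lx ⟩
      length xs                   ≡⟨ lenx ⟩
      cycleLength x + length ys   ≤⟨ +-monoˡ-≤ (length ys) (Cycle.short x) ⟩
      N + length ys               ∎)
      where open ≤-Reasoning
  ... | mkCyclesRemoval zs cl count lenys monoys keepsys withinys bases∈ removed⊆ =
    mkCyclesRemoval zs (x ∷ cl) (cong suc count)
      (trans lenx (trans (cong (cycleLength x +_) lenys) (sym (+-assoc (cycleLength x) _ _))))
      (trans monox (trans (cong (cycleMono x +ᵥ_) monoys) (sym (+ᵥ-assoc _ _ _))))
      (λ y q → keepsys y (keepsx y q)) (λ y q → withinx y (withinys y q))
      bases∈′ removed⊆′
    where
    bases∈′ : ∀ x′ → x′ ∈ x ∷ cl → base x′ ∈ s ∷ zs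
    bases∈′ x′ (here refl) = keepsys _ basex∈
    bases∈′ x′ (there q) = bases∈ x′ q
    removed⊆′ : ∀ x′ → x′ ∈ x ∷ cl → ∀ y → y ∈ vertices x′ → y ∈ s ∷ xs
    removed⊆′ x′ (here refl) y q = x⊆ y q
    removed⊆′ x′ (there q) y r = withinx y (removed⊆ x′ q y r)

  record CyclesInsertion (s : Vertex) (xs : List Vertex) (cl : List Cycle) : Set where
    constructor mkCyclesInsertion
    field
      walk : List Vertex
      length-walk : length walk ≡ totalLength cl + length xs
      walkMono-walk : walkMono s walk ≡ cyclesMono cl +ᵥ walkMono s xs
      keeps : ∀ y → y ∈ s ∷ xs → y ∈ s ∷ walk
      adds : ∀ y → y ∈ s ∷ walk → y ∈ s ∷ xs ⊎ (Σ Cycle λ x → x ∈ cl × y ∈ vertices x)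

  insertCycles : ∀ s xs cl → (∀ x → x ∈ cl → base x ∈ s ∷ xs) → CyclesInsertion s xs cl
  insertCycles s xs [] _ = mkCyclesInsertion xs refl (sym (+ᵥ-identityˡ _)) (λ _ q → q) (λ _ q → inj₁ q)
  insertCycles s xs (x ∷ cl) bases∈ with insertCycles s xs cl (λ x′ q → bases∈ x′ (there q))
  ... | mkCyclesInsertion ys len mono keeps adds
    with insert s ys (base x) (vertices x) (keeps _ (bases∈ x (here refl))) (closed x)
  ...   | mkInsertion zs len′ mono′ keeps′ adds′ =
    mkCyclesInsertion zs
      (trans len′ (trans (cong (cycleLength x +_) len) (sym (+-assoc (cycleLength x) _ _))))
      (trans mono′ (trans (cong (cycleMono x +ᵥ_) mono) (sym (+ᵥ-assoc _ _ _))))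
      (λ y q → keeps′ y (keeps y q)) adds″
    where
    adds″ : ∀ y → y ∈ s ∷ zs → y ∈ s ∷ xs ⊎ (Σ Cycle λ x′ → x′ ∈ x ∷ cl × y ∈ vertices x′)
    adds″ y q with adds′ y q
    ... | inj₂ r = inj₂ (x , here refl , r)
    ... | inj₁ r with adds y r
    ...   | inj₁ r′ = inj₁ r′
    ...   | inj₂ (x′ , p , r′) = inj₂ (x′ , there p , r′)

  record Split (cl ch rest : List Cycle) : Set where
    constructor mkSplit
    field
      mono : cyclesMono cl ≡ cyclesMono ch +ᵥ cyclesMono rest
      total : totalLength cl ≡ totalLength ch + totalLength rest
      count : length cl ≡ length ch + length rest
      left⊆ : ∀ x → x ∈ ch → x ∈ cl
      right⊆ : ∀ x → x ∈ rest → x ∈ cl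

  split-[] : Split [] [] []
  split-[] = mkSplit (sym (+ᵥ-identityˡ _)) refl refl (λ _ ()) (λ _ ())

  split-left : ∀ {cl ch rest} x → Split cl ch rest → Split (x ∷ cl) (x ∷ ch) rest
  split-left {ch = ch} x (mkSplit mono total count left⊆ right⊆) =
    mkSplit (trans (cong (_ +ᵥ_) mono) (sym (+ᵥ-assoc _ _ _)))
            (trans (cong (cycleLength x +_) total) (sym (+-assoc (cycleLength x) (totalLength ch) _)))
            (cong suc count)
            (λ { y (here e) → here e ; y (there q) → there (left⊆ y q) })
            (λ y q → there (right⊆ y q))

  split-right : ∀ {cl ch rest} x → Split cl ch rest → Split (x ∷ cl) ch (x ∷ rest)
  split-right {ch = ch} x (mkSplit mono total count left⊆ right⊆) =
    mkSplit (trans (cong (_ +ᵥ_) mono) (+ᵥ-swap _ _ _))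
            (trans (cong (cycleLength x +_) total) (+-swap (cycleLength x) (totalLength ch) _))
            (trans (cong suc count) (sym (+-suc (length ch) _)))
            (λ y q → there (left⊆ y q))
            (λ { y (here e) → here e ; y (there q) → there (right⊆ y q) })

  split-swap : ∀ {cl ch rest} → Split cl ch rest → Split cl rest ch
  split-swap {ch = ch} (mkSplit mono total count left⊆ right⊆) =
    mkSplit (trans mono (+ᵥ-comm _ _)) (trans total (+-comm (totalLength ch) _))
            (trans count (+-comm (length ch) _)) right⊆ left⊆

  split-++ : ∀ a b → Split (a ++ b) a b
  split-++ a b =
    mkSplit (cyclesMono-++ a b) (totalLength-++ a b) (length-++ a) (λ _ → ∈-++⁺ˡ) (λ _ → ∈-++⁺ʳ a)

  split-refine : ∀ {cl ch rest a b} → Split cl ch rest → Split ch a b → Split cl a (b ++ rest)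
  split-refine {rest = rest} {a} {b} (mkSplit mono total count left⊆ right⊆)
                                     (mkSplit mono′ total′ count′ left⊆′ right⊆′) =
    mkSplit (trans mono (trans (cong (_+ᵥ cyclesMono rest) mono′)
              (trans (+ᵥ-assoc _ _ _) (cong (cyclesMono a +ᵥ_) (sym (cyclesMono-++ b rest))))))
            (trans total (trans (cong (_+ totalLength rest) total′)
              (trans (+-assoc (totalLength a) _ _) (cong (totalLength a +_) (sym (totalLength-++ b rest))))))
            (trans count (trans (cong (_+ length rest) count′)
              (trans (+-assoc (length a) _ _) (cong (length a +_) (sym (length-++ b))))))
            (λ x q → left⊆ x (left⊆′ x q))
            right⊆″
    where
    right⊆″ : ∀ x → x ∈ b ++ rest → x ∈ _
    right⊆″ x q with ∈-++⁻ b q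
    ... | inj₁ r = left⊆ x (right⊆′ x r)
    ... | inj₂ r = right⊆ x r

  partitionByLength : ∀ ℓ cl → Σ (List Cycle) λ ch → Σ (List Cycle) λ rest →
    Split cl ch rest × (∀ x → x ∈ ch → cycleLength x ≡ ℓ) × (∀ x → x ∈ rest → cycleLength x ≢ ℓ)
  partitionByLength ℓ [] = [] , [] , split-[] , (λ _ ()) , (λ _ ())
  partitionByLength ℓ (x ∷ cl) with partitionByLength ℓ cl | cycleLength x ≟ ℓ
  ... | ch , rest , sp , ch≡ , rest≢ | yes e =
    x ∷ ch , rest , split-left x sp , (λ { y (here refl) → e ; y (there q) → ch≡ y q }) , rest≢
  ... | ch , rest , sp , ch≡ , rest≢ | no ne =
    ch , x ∷ rest , split-right x sp , ch≡ , (λ { y (here refl) → ne ; y (there q) → rest≢ y q })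

  equalLengths : ∀ c B cl → (∀ x → x ∈ cl → 1 ≤ cycleLength x × cycleLength x ≤ B) →
                 suc (B * (c ∸ 1)) ≤ length cl →
                 Σ ℕ λ ℓ → 1 ≤ ℓ × ℓ ≤ B × Σ (List Cycle) λ ch → Σ (List Cycle) λ rest →
                   Split cl ch rest × c ≤ length ch × (∀ x → x ∈ ch → cycleLength x ≡ ℓ)
  equalLengths c zero (x ∷ cl) bounds _ with bounds x (here refl)
  ... | lo , hi with ≤-trans lo hi
  ...   | ()
  equalLengths c (suc B) cl bounds long with partitionByLength (suc B) cl
  ... | ch , rest , sp , ch≡ , rest≢ with c ≤? length ch
  ...   | yes enough = suc B , s≤s z≤n , ≤-refl , ch , rest , sp , enough , ch≡
  ...   | no few with equalLengths c B rest boundsRest longRest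
    where
    boundsRest : ∀ x → x ∈ rest → 1 ≤ cycleLength x × cycleLength x ≤ B
    boundsRest x q with bounds x (Split.right⊆ sp x q)
    ... | lo , hi = lo , s≤s⁻¹ (≤∧≢⇒< hi (rest≢ x q))
    fewCh : length ch ≤ c ∸ 1
    fewCh = ≤-pred (≤-trans (≰⇒> few) (m≤n+m∸n c 1))
    longRest : suc (B * (c ∸ 1)) ≤ length rest
    longRest = +-cancelˡ-≤ (c ∸ 1) _ _ (begin
      (c ∸ 1) + suc (B * (c ∸ 1)) ≡⟨ +-suc (c ∸ 1) _ ⟩
      suc (suc B * (c ∸ 1))       ≤⟨ long ⟩
      length cl                   ≡⟨ Split.count sp ⟩
      length ch + length rest     ≤⟨ +-monoˡ-≤ (length rest) fewCh ⟩
      (c ∸ 1) + length rest       ∎)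
      where open ≤-Reasoning
  ...     | ℓ , lo , hi , ch′ , rest′ , sp′ , enough , ch′≡ =
    ℓ , lo , m≤n⇒m≤1+n hi , ch′ , rest′ ++ ch , split-refine (split-swap sp) sp′ , enough , ch′≡

  record PumpStep (c : ℕ) (e : ℕ → ℕ) (s : Vertex) (xs : List Vertex) : Set where
    constructor mkPumpStep
    field
      walk : List Vertex
      ℓ : ℕ
      pumped : List Cycle
      length-walk : length xs ≡ c + length walk
      walkMono-walk : walkMono s xs ≡ cyclesMono pumped +ᵥ walkMono s walk
      keeps : ∀ y → y ∈ s ∷ xs → y ∈ s ∷ walk
      within : ∀ y → y ∈ s ∷ walk → y ∈ s ∷ xs
      ℓ-pos : 1 ≤ ℓ
      ℓ≤N : ℓ ≤ N
      count : length pumped ≡ e ℓ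
      uniform : ∀ x → x ∈ pumped → cycleLength x ≡ ℓ
      bases∈ : ∀ x → x ∈ pumped → base x ∈ s ∷ xs

  -- Remove N·c cycles; by the pigeonhole principle c of them have a common length ℓ;
  -- keep e ℓ ≤ c of those and re-insert all the others.
  pumpStep : ∀ c (e : ℕ → ℕ) → 1 ≤ N → 1 ≤ c → (∀ ℓ → 1 ≤ ℓ → ℓ ≤ N → e ℓ * ℓ ≡ c) →
             ∀ s xs → N * c * N + suc N * suc N ≤ length xs → PumpStep c e s xs
  pumpStep c e N≥1 c≥1 e-div s xs lx with removeCycles (N * c) s xs lx
  ... | mkCyclesRemoval ys cl count lenys monoys keeps within bases∈ removed⊆
    with equalLengths c N cl (λ x _ → Cycle.nonempty x , Cycle.short x)
           (subst (suc (N * (c ∸ 1)) ≤_) (sym count) (many N≥1 c≥1))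
    where
    many : ∀ {N c} → 1 ≤ N → 1 ≤ c → suc (N * (c ∸ 1)) ≤ N * c
    many {suc N} {suc c} _ _ = s≤s (+-monoʳ-≤ c (*-monoʳ-≤ N (n≤1+n c)))
  ... | ℓ , ℓ-pos , ℓ≤N , ch , rest , sp , enough , ch≡
    with splitPrefix (e ℓ) ch (≤-trans (factor≤ ℓ-pos (e-div ℓ ℓ-pos ℓ≤N)) enough)
    where
    factor≤ : ∀ {m n k} → 1 ≤ n → m * n ≡ k → m ≤ k
    factor≤ {m} {suc n} _ eq = subst (m ≤_) eq (m≤m*n m (suc n))
  ... | pumped , others , refl , count′ with insertCycles s ys (others ++ rest) others∈
    where
    others∈ : ∀ x → x ∈ others ++ rest → base x ∈ s ∷ ys
    others∈ x q = bases∈ x (Split.right⊆ (split-refine sp (split-++ pumped others)) x q)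
  ... | mkCyclesInsertion zs lenzs monozs keeps′ adds′ =
    mkPumpStep zs ℓ pumped lengths monos (λ y q → keeps′ y (keeps y q)) within′ ℓ-pos ℓ≤N count′
      uniform (λ x q → within _ (bases∈ x (Split.left⊆ sp′ x q)))
    where
    sp′ = split-refine sp (split-++ pumped others)
    uniform : ∀ x → x ∈ pumped → cycleLength x ≡ ℓ
    uniform x q = ch≡ x (∈-++⁺ˡ q)
    pumpedLength : totalLength pumped ≡ c
    pumpedLength = trans (totalLength-uniform ℓ pumped uniform)
                         (trans (cong (_* ℓ) count′) (e-div ℓ ℓ-pos ℓ≤N))
    lengths : length xs ≡ c + length zs
    lengths = begin
      length xs                                                 ≡⟨ lenys ⟩
      totalLength cl + length ys                                ≡⟨ cong (_+ length ys) (Split.total sp′) ⟩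
      (totalLength pumped + totalLength (others ++ rest)) + length ys ≡⟨ +-assoc (totalLength pumped) _ _ ⟩
      totalLength pumped + (totalLength (others ++ rest) + length ys) ≡⟨ cong₂ _+_ pumpedLength (sym lenzs) ⟩
      c + length zs                                             ∎
      where open ≡-Reasoning
    monos : walkMono s xs ≡ cyclesMono pumped +ᵥ walkMono s zs
    monos = begin
      walkMono s xs                                             ≡⟨ monoys ⟩
      cyclesMono cl +ᵥ walkMono s ys                            ≡⟨ cong (_+ᵥ walkMono s ys) (Split.mono sp′) ⟩
      (cyclesMono pumped +ᵥ cyclesMono (others ++ rest)) +ᵥ walkMono s ys ≡⟨ +ᵥ-assoc _ _ _ ⟩
      cyclesMono pumped +ᵥ (cyclesMono (others ++ rest) +ᵥ walkMono s ys) ≡⟨ cong (cyclesMono pumped +ᵥ_) (sym monozs) ⟩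
      cyclesMono pumped +ᵥ walkMono s zs                        ∎
      where open ≡-Reasoning
    within′ : ∀ y → y ∈ s ∷ zs → y ∈ s ∷ xs
    within′ y q with adds′ y q
    ... | inj₁ r = within y r
    ... | inj₂ (x , x∈ , y∈x) = removed⊆ x (Split.right⊆ sp′ x x∈) y y∈x

  lookup-+ᵥ : ∀ (a b : Mono N) x → lookup (a +ᵥ b) x ≡ lookup a x + lookup b x
  lookup-+ᵥ a b x = lookup-zipWith _+_ x a b

  lookup-unitMono : ∀ v x → lookup (unitMono {N} v) x ≤ 1
  lookup-unitMono v x rewrite lookup∘tabulate (λ w → if ⌊ v Fin.≟ w ⌋ then 1 else 0) x
    with ⌊ v Fin.≟ x ⌋
  ... | true = ≤-refl
  ... | false = z≤n

  pathMono-bound : ∀ s xs x → lookup (pathMono s xs) x ≤ length xs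
  pathMono-bound s [] x = ≤-reflexive (lookup-replicate x 0)
  pathMono-bound s (y ∷ xs) x rewrite lookup-+ᵥ (monoA s y) (pathMono y xs) x =
    +-mono-≤ (lookup-unitMono _ x) (pathMono-bound y xs x)

  walkMono-bound : ∀ s xs x → lookup (walkMono s xs) x ≤ suc (length xs)
  walkMono-bound s [] x = lookup-unitMono _ x
  walkMono-bound s (y ∷ xs) x rewrite lookup-+ᵥ (monoA s y) (walkMono y xs) x =
    +-mono-≤ (lookup-unitMono _ x) (walkMono-bound y xs x)

  termMono-bound : ∀ s xs x → lookup (monoC s +ᵥ walkMono s xs) x ≤ suc (suc (length xs))
  termMono-bound s xs x rewrite lookup-+ᵥ (monoC s) (walkMono s xs) x =
    +-mono-≤ (lookup-unitMono _ x) (walkMono-bound s xs x)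

  cyclesMono-bound : ∀ cl x → lookup (cyclesMono cl) x ≤ totalLength cl
  cyclesMono-bound [] x = ≤-reflexive (lookup-replicate x 0)
  cyclesMono-bound (y ∷ cl) x rewrite lookup-+ᵥ (cycleMono y) (cyclesMono cl) x =
    +-mono-≤ (pathMono-bound (base y) (vertices y) x) (cyclesMono-bound cl x)

module Counting where
  open import Data.Nat using (suc; zero; _+_; s≤s)
  open import Data.Bool using (Bool; true; false; if_then_else_)
  open import Data.Fin using (zero; suc; finToFun; funToFin)
  open import Data.Fin.Properties using (finToFun-funToFin)
  open import Data.Vec using (Vec; []; _∷_; lookup)
  open import Data.List using (List; []; _∷_; map; upTo; length; cartesianProductWith)
  open import Data.List.Properties using (length-++; length-map; length-upTo)
  open import Data.List.Relation.Unary.Any using (here)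
  open import Data.List.Membership.Propositional using (_∈_)
  open import Data.List.Membership.Propositional.Properties using (∈-upTo⁺; ∈-cartesianProductWith⁺)
  open import Relation.Binary.PropositionalEquality

  length-cartesianProductWith : ∀ {A B C : Set} (f : A → B → C) xs ys →
    length (cartesianProductWith f xs ys) ≡ length xs * length ys
  length-cartesianProductWith f [] ys = refl
  length-cartesianProductWith f (x ∷ xs) ys =
    trans (length-++ (map (f x) ys)) (cong₂ _+_ (length-map (f x) ys) (length-cartesianProductWith f xs ys))

  boundedVecs : ∀ n → ℕ → List (Vec ℕ n)
  boundedVecs zero D = [] ∷ []
  boundedVecs (suc n) D = cartesianProductWith _∷_ (upTo (suc D)) (boundedVecs n D)

  length-boundedVecs : ∀ n D → length (boundedVecs n D) ≡ suc D ^ n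
  length-boundedVecs zero D = refl
  length-boundedVecs (suc n) D =
    trans (length-cartesianProductWith _∷_ (upTo (suc D)) (boundedVecs n D))
          (cong₂ _*_ (length-upTo (suc D)) (length-boundedVecs n D))

  ∈-boundedVecs : ∀ n D (v : Vec ℕ n) → (∀ x → lookup v x ≤ D) → v ∈ boundedVecs n D
  ∈-boundedVecs zero D [] _ = here refl
  ∈-boundedVecs (suc n) D (y ∷ v) bounded =
    ∈-cartesianProductWith⁺ _∷_ (∈-upTo⁺ (s≤s (bounded zero)))
      (∈-boundedVecs n D v (λ x → bounded (suc x)))

  -- the vertex set coded by i : Fin (2 ^ n); every set of vertices has a code
  bit : Fin 2 → Bool
  bit zero = false
  bit (suc _) = true

  subsetOf : ∀ {n} → Fin (2 ^ n) → Fin n → Bool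
  subsetOf i y = bit (finToFun {2} i y)

  encode : ∀ {n} → (Fin n → Bool) → Fin (2 ^ n)
  encode U = funToFin (λ y → if U y then suc zero else zero)

  subsetOf-encode : ∀ {n} (U : Fin n → Bool) y → subsetOf (encode U) y ≡ U y
  subsetOf-encode U y =
    trans (cong bit (finToFun-funToFin (λ y → if U y then suc zero else zero) y)) (bit-if (U y))
    where
    bit-if : ∀ b → bit (if b then suc zero else zero) ≡ b
    bit-if true = refl
    bit-if false = refl

module FactorialBounds where
  open import Data.Nat using (zero; suc; _+_; z≤n; s≤s)
  open import Data.Nat.Properties
  open import Data.Nat.Tactic.RingSolver using (solve-∀)
  open import Relation.Binary.PropositionalEquality
  open ≤-Reasoning

  n≤2^n : ∀ n → n ≤ 2 ^ n
  n≤2^n zero = z≤n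
  n≤2^n (suc n) = begin
    suc n         ≤⟨ s≤s (n≤2^n n) ⟩
    1 + 2 ^ n     ≤⟨ +-monoˡ-≤ (2 ^ n) (m^n>0 2 n) ⟩
    2 ^ n + 2 ^ n ≡⟨ cong (2 ^ n +_) (sym (+-identityʳ (2 ^ n))) ⟩
    2 ^ suc n     ∎

  n≤n! : ∀ n → n ≤ n !
  n≤n! zero = z≤n
  n≤n! (suc n) = subst (_≤ suc n * n !) (*-identityʳ (suc n)) (*-monoʳ-≤ (suc n) (1≤n! n))

  n!≤2^[n*n] : ∀ n → n ! ≤ 2 ^ (n * n)
  n!≤2^[n*n] n = begin
    n !            ≤⟨ n!≤n^n n ⟩
    n ^ n          ≤⟨ ^-monoˡ-≤ n (n≤2^n n) ⟩
    (2 ^ n) ^ n    ≡⟨ ^-*-assoc 2 n n ⟩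
    2 ^ (n * n)    ∎
    where
    n!≤n^n : ∀ n → n ! ≤ n ^ n
    n!≤n^n zero = ≤-refl
    n!≤n^n (suc n) = *-monoʳ-≤ (suc n) (≤-trans (n!≤n^n n) (^-monoˡ-≤ n (n≤1+n n)))

  -- the factorial dominates the quartic (2 + n)^4, since (5+m)^4 ≤ (3+m)·(4+m)^4
  quartic≤factorial : ∀ n → (2 + n) ^ 4 ≤ 128 * n !
  quartic≤factorial zero = m≤m+n 16 112
  quartic≤factorial (suc zero) = m≤m+n 81 47
  quartic≤factorial (suc (suc m)) = from2 m
    where
    -- (x ^ 4 unfolds to x * (x * (x * (x * 1))); the ring solver does not accept _^_)
    growth : ∀ m → (3 + m) * ((4 + m) * ((4 + m) * ((4 + m) * ((4 + m) * 1))))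
                 ≡ (5 + m) * ((5 + m) * ((5 + m) * ((5 + m) * 1)))
                   + (m * m * m * m * m + 18 * m * m * m * m + 124 * m * m * m + 394 * m * m + 524 * m + 143)
    growth = solve-∀
    from2 : ∀ m → (4 + m) ^ 4 ≤ 128 * (2 + m) !
    from2 zero = ≤-refl
    from2 (suc m) = begin
      (5 + m) ^ 4                      ≤⟨ m≤m+n _ _ ⟩
      (5 + m) ^ 4 + _                  ≡⟨ sym (growth m) ⟩
      (3 + m) * (4 + m) ^ 4            ≤⟨ *-monoʳ-≤ (3 + m) (from2 m) ⟩
      (3 + m) * (128 * (2 + m) !)      ≡⟨ x∙yz≈y∙xz (3 + m) 128 ((2 + m) !) ⟩
      128 * (3 + m) !                  ∎
      where
      open import Algebra.Properties.CommutativeSemigroup *-commutativeSemigroup using (x∙yz≈y∙xz)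

-- the constant of the O-bounds in the theorem
C₀ : ℕ
C₀ = 512

module Sizes (N : ℕ) where
  open FactorialBounds
  open import Data.Nat using (suc; _+_; z≤n; s≤s; NonZero; >-nonZero)
  open import Data.Nat.Properties
  open import Data.Nat.Tactic.RingSolver using (solve-∀)
  open import Relation.Binary.PropositionalEquality
  open ≤-Reasoning

  c : ℕ
  c = N !

  κ : ℕ
  κ = N * N + suc N * suc N

  T : ℕ
  T = κ * c

  -- every exponent occurring in a P-, u- or q-polynomial is at most D
  D : ℕ
  D = T + c + 2

  -- walks of length ≥ T are long enough to apply pumpStep
  threshold : N * c * N + suc N * suc N ≤ T
  threshold = begin
    N * c * N + suc N * suc N     ≤⟨ +-monoʳ-≤ (N * c * N) (m≤m*n (suc N * suc N) c) ⟩
    N * c * N + suc N * suc N * c ≡⟨ regroup N c ⟩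
    T                             ∎
    where
    instance
      c≢0 : NonZero c
      c≢0 = >-nonZero (1≤n! N)
    regroup : ∀ N c → N * c * N + suc N * suc N * c ≡ (N * N + suc N * suc N) * c
    regroup = solve-∀

  private
    -- 2^E bounds the number D+1 of possible exponent values; E and the number of
    -- variables are both O((N+2)²), and (N+2)⁴ = O(N!)
    E : ℕ
    E = κ + 4 + N * N

    square : ℕ
    square = (2 + N) * (2 + N)

    E≤4square : E ≤ 4 * square
    E≤4square = subst (E ≤_) (sym (identity N)) (m≤m+n E _)
      where
      identity : ∀ N → 4 * ((2 + N) * (2 + N))
                       ≡ (N * N + suc N * suc N + 4 + N * N) + (N * N + 14 * N + 11)
      identity = solve-∀

    nVars≤square : nVars N ≤ square
    nVars≤square = subst (nVars N ≤_) (sym (identity N)) (m≤m+n (nVars N) _)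
      where
      identity : ∀ N → (2 + N) * (2 + N) ≡ (N + N + N * N) + (2 * N + 4)
      identity = solve-∀

    4square²≤ : 4 * (square * square) ≤ C₀ * N !
    4square²≤ = begin
      4 * (square * square)   ≡⟨ cong (4 *_) (square² N) ⟩
      4 * (2 + N) ^ 4         ≤⟨ *-monoʳ-≤ 4 (quartic≤factorial N) ⟩
      4 * (128 * N !)         ≡⟨ sym (*-assoc 4 128 (N !)) ⟩
      C₀ * N !                ∎
      where
      square² : ∀ N → (2 + N) * (2 + N) * ((2 + N) * (2 + N)) ≡ (2 + N) * ((2 + N) * ((2 + N) * ((2 + N) * 1)))
      square² = solve-∀

    1+D≤2^E : suc D ≤ 2 ^ E
    1+D≤2^E = begin
      suc D                  ≡⟨ sym (+-suc (T + c) 2) ⟩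
      T + c + 3              ≤⟨ +-monoʳ-≤ (T + c) (*-monoʳ-≤ 3 (1≤n! N)) ⟩
      T + c + 3 * c          ≡⟨ sym (identity κ c) ⟩
      (κ + 4) * c            ≤⟨ *-mono-≤ (n≤2^n (κ + 4)) (n!≤2^[n*n] N) ⟩
      2 ^ (κ + 4) * 2 ^ (N * N) ≡⟨ sym (^-distribˡ-+-* 2 (κ + 4) (N * N)) ⟩
      2 ^ E                  ∎
      where
      identity : ∀ κ c → (κ + 4) * c ≡ κ * c + c + 3 * c
      identity = solve-∀

  κ≤ : κ ≤ C₀ * N !
  κ≤ = begin
    κ                     ≤⟨ ≤-trans (m≤m+n κ 4) (m≤m+n (κ + 4) (N * N)) ⟩
    E                     ≤⟨ E≤4square ⟩
    4 * square            ≤⟨ *-monoʳ-≤ 4 (m≤m*n square square) ⟩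
    4 * (square * square) ≤⟨ 4square²≤ ⟩
    C₀ * N !              ∎
    where
    instance
      square≢0 : NonZero square
      square≢0 = _

  ρ≤ : 2 ^ N * c ≤ 2 ^ (C₀ * N !)
  ρ≤ = begin
    2 ^ N * N !           ≤⟨ *-mono-≤ (^-monoʳ-≤ 2 (n≤n! N)) (n≤2^n (N !)) ⟩
    2 ^ (N !) * 2 ^ (N !) ≡⟨ sym (^-distribˡ-+-* 2 (N !) (N !)) ⟩
    2 ^ (N ! + N !)       ≡⟨ cong (λ k → 2 ^ (N ! + k)) (sym (+-identityʳ (N !))) ⟩
    2 ^ (2 * N !)         ≤⟨ ^-monoʳ-≤ 2 (*-monoˡ-≤ (N !) {2} {C₀} (s≤s (s≤s z≤n))) ⟩
    2 ^ (C₀ * N !)        ∎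

  -- the number of exponent vectors with entries ≤ D
  monomials≤ : suc D ^ nVars N ≤ 2 ^ (C₀ * N !)
  monomials≤ = begin
    suc D ^ nVars N       ≤⟨ ^-monoˡ-≤ (nVars N) 1+D≤2^E ⟩
    (2 ^ E) ^ nVars N     ≡⟨ ^-*-assoc 2 E (nVars N) ⟩
    2 ^ (E * nVars N)     ≤⟨ ^-monoʳ-≤ 2 (≤-trans (*-mono-≤ E≤4square nVars≤square)
                                                   (≤-trans (≤-reflexive (*-assoc 4 square square)) 4square²≤)) ⟩
    2 ^ (C₀ * N !)        ∎

-- A polynomial
-- is a list of (coefficient, monomial) terms; m ∈ₘ p says that m is listed in p.  If
-- every listed coefficient is 1 and K is idempotent, the coefficient of m is 1 or 0
-- according to whether m is listed, so such polynomials are equal iff they have the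
-- same support.
module Support {a ℓ} (K : CommutativeSemiring a ℓ) (N : ℕ) where
  open ExponentVectors
  open CommutativeSemiring K using (0#; 1#; _≈_; refl; sym; trans; +-cong; *-cong; *-identityˡ; +-identityʳ)
    renaming (_*_ to _⊗_)
  open WithK K using (Idempotent)
  open WithK.Polys K N
  open import Data.Nat using (zero; suc; _+_; _<_; _<?_; _≟_)
  open import Data.Nat.Properties using (<-irrelevant)
  open import Data.Bool using (true; false; if_then_else_)
  open import Data.Fin using (Fin; fromℕ<)
  open import Data.Vec using (zipWith)
  open import Data.Vec.Properties using (≡-dec)
  open import Data.List using ([]; _∷_; map; concatMap; allFin; upTo)
  open import Data.List.Relation.Unary.Any using (Any; here; there; any?)
  import Data.List.Relation.Unary.Any as Any
  open import Data.List.Relation.Unary.Any.Properties using (++⁺ˡ; ++⁺ʳ; ++⁻; concatMap⁺; concatMap⁻; map⁺; map⁻)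
  open import Data.List.Relation.Unary.All using (All; []; _∷_)
  open import Data.List.Relation.Unary.All.Properties using (++⁺)
  open import Data.List.Membership.Propositional using (find; lose)
  open import Data.List.Membership.Propositional.Properties using (∈-allFin; ∈-upTo⁺)
  open import Data.Product using (proj₁; proj₂)
  open import Data.Sum using (_⊎_)
  open import Data.Empty using (⊥-elim)
  open import Relation.Nullary using (¬_; yes; no; Dec)
  open import Relation.Nullary.Decidable using (⌊_⌋)
  open import Relation.Binary.PropositionalEquality as ≡ using (_≡_; subst)

  infix 4 _∈ₘ_

  _∈ₘ_ : MonoN → Poly → Set a
  m ∈ₘ p = Any (λ t → proj₂ t ≡ m) p

  ∈ₘ-⊕⁺ˡ : ∀ {m} p q → m ∈ₘ p → m ∈ₘ (p ⊕P q)
  ∈ₘ-⊕⁺ˡ p q = ++⁺ˡ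

  ∈ₘ-⊕⁺ʳ : ∀ {m} p q → m ∈ₘ q → m ∈ₘ (p ⊕P q)
  ∈ₘ-⊕⁺ʳ p q = ++⁺ʳ p

  ∈ₘ-⊕⁻ : ∀ {m} p q → m ∈ₘ (p ⊕P q) → m ∈ₘ p ⊎ m ∈ₘ q
  ∈ₘ-⊕⁻ p q = ++⁻ p

  ∈ₘ-var⁺ : ∀ v → unitMono {N} v ∈ₘ var v
  ∈ₘ-var⁺ v = here ≡.refl

  ∈ₘ-var⁻ : ∀ {m} v → m ∈ₘ var v → m ≡ unitMono {N} v
  ∈ₘ-var⁻ v (here e) = ≡.sym e

  ∈ₘ-one⁺ : 0ᵥ ∈ₘ oneP
  ∈ₘ-one⁺ = here ≡.refl

  ∈ₘ-one⁻ : ∀ {m} → m ∈ₘ oneP → m ≡ 0ᵥ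
  ∈ₘ-one⁻ (here e) = ≡.sym e

  ∈ₘ-⊗⁺ : ∀ {m₁ m₂} p q → m₁ ∈ₘ p → m₂ ∈ₘ q → (m₁ +ᵥ m₂) ∈ₘ (p ⊗P q)
  ∈ₘ-⊗⁺ p q w₁ w₂ with find w₁ | find w₂
  ... | t₁ , t₁∈p , ≡.refl | t₂ , t₂∈q , ≡.refl = concatMap⁺ _ (lose t₁∈p (map⁺ (lose t₂∈q ≡.refl)))

  ∈ₘ-⊗⁻ : ∀ {m} p q → m ∈ₘ (p ⊗P q) →
          Σ MonoN λ m₁ → Σ MonoN λ m₂ → m₁ ∈ₘ p × m₂ ∈ₘ q × m ≡ m₁ +ᵥ m₂
  ∈ₘ-⊗⁻ p q w with find (concatMap⁻ _ {xs = p} w)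
  ... | (x , m₁) , t₁∈p , w′ with find (map⁻ w′)
  ...   | (y , m₂) , t₂∈q , e = m₁ , m₂ , Any.map (λ e → ≡.cong proj₂ (≡.sym e)) t₁∈p ,
                                Any.map (λ e → ≡.cong proj₂ (≡.sym e)) t₂∈q , ≡.sym e

  ∈ₘ-sumFin⁺ : ∀ {m} n (f : Fin n → Poly) i → m ∈ₘ f i → m ∈ₘ sumFin n f
  ∈ₘ-sumFin⁺ n f i w = concatMap⁺ f (lose (∈-allFin i) w)

  ∈ₘ-sumFin⁻ : ∀ {m} n (f : Fin n → Poly) → m ∈ₘ sumFin n f → Σ (Fin n) λ i → m ∈ₘ f i
  ∈ₘ-sumFin⁻ n f w with find (concatMap⁻ f {xs = allFin n} w)
  ... | i , _ , w′ = i , w′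

  ∈ₘ-if⁺ : ∀ {m} b p → b ≡ true → m ∈ₘ p → m ∈ₘ (if b then p else zeroP)
  ∈ₘ-if⁺ true p _ w = w

  ∈ₘ-if⁻ : ∀ {m} b p → m ∈ₘ (if b then p else zeroP) → b ≡ true × m ∈ₘ p
  ∈ₘ-if⁻ true p w = ≡.refl , w

  ∈ₘ-ifDec⁺ : ∀ {P : Set} {m} (d : Dec P) p → P → m ∈ₘ p → m ∈ₘ (if ⌊ d ⌋ then p else zeroP)
  ∈ₘ-ifDec⁺ (yes _) p _ w = w
  ∈ₘ-ifDec⁺ (no ¬x) p x _ = ⊥-elim (¬x x)

  ∈ₘ-ifDec⁻ : ∀ {P : Set} {m} (d : Dec P) p → m ∈ₘ (if ⌊ d ⌋ then p else zeroP) → P × m ∈ₘ p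
  ∈ₘ-ifDec⁻ (yes x) p w = x , w

  data Power (p : Poly) : ℕ → MonoN → Set a where
    power-zero : Power p zero 0ᵥ
    power-suc : ∀ {k m₁ m₂} → m₁ ∈ₘ p → Power p k m₂ → Power p (suc k) (m₁ +ᵥ m₂)

  ∈ₘ-powP⁺ : ∀ {m} p k → Power p k m → m ∈ₘ powP p k
  ∈ₘ-powP⁺ p zero power-zero = ∈ₘ-one⁺
  ∈ₘ-powP⁺ p (suc k) (power-suc w ws) = ∈ₘ-⊗⁺ p (powP p k) w (∈ₘ-powP⁺ p k ws)

  ∈ₘ-powP⁻ : ∀ {m} p k → m ∈ₘ powP p k → Power p k m
  ∈ₘ-powP⁻ p zero w rewrite ∈ₘ-one⁻ w = power-zero
  ∈ₘ-powP⁻ p (suc k) w with ∈ₘ-⊗⁻ p (powP p k) w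
  ... | m₁ , m₂ , w₁ , w₂ , ≡.refl = power-suc w₁ (∈ₘ-powP⁻ p k w₂)

  UnitCoeffs : Poly → Set (a Level.⊔ ℓ)
  UnitCoeffs p = All (λ t → proj₁ t ≈ 1#) p

  unit-⊕ : ∀ {p q} → UnitCoeffs p → UnitCoeffs q → UnitCoeffs (p ⊕P q)
  unit-⊕ = ++⁺

  unit-zero : UnitCoeffs zeroP
  unit-zero = []

  unit-one : UnitCoeffs oneP
  unit-one = refl ∷ []

  unit-var : ∀ v → UnitCoeffs (var v)
  unit-var v = refl ∷ []

  unit-concatMap : ∀ {A : Set} (f : A → Poly) xs → (∀ x → UnitCoeffs (f x)) → UnitCoeffs (concatMap f xs)
  unit-concatMap f [] _ = []
  unit-concatMap f (x ∷ xs) unit = ++⁺ (unit x) (unit-concatMap f xs unit)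

  unit-⊗ : ∀ p q → UnitCoeffs p → UnitCoeffs q → UnitCoeffs (p ⊗P q)
  unit-⊗ [] q _ _ = []
  unit-⊗ ((x , m) ∷ p) q (x≈1 ∷ unitp) unitq = ++⁺ (scaled q unitq) (unit-⊗ p q unitp unitq)
    where
    scaled : ∀ q → UnitCoeffs q → UnitCoeffs (map (λ { (y , m′) → (x ⊗ y , zipWith _+_ m m′) }) q)
    scaled [] _ = []
    scaled ((y , m′) ∷ q) (y≈1 ∷ unitq) = trans (*-cong x≈1 y≈1) (*-identityˡ 1#) ∷ scaled q unitq

  unit-powP : ∀ p k → UnitCoeffs p → UnitCoeffs (powP p k)
  unit-powP p zero _ = unit-one
  unit-powP p (suc k) unit = unit-⊗ p (powP p k) unit (unit-powP p k unit)

  unit-sumFin : ∀ n (f : Fin n → Poly) → (∀ i → UnitCoeffs (f i)) → UnitCoeffs (sumFin n f)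
  unit-sumFin n f = unit-concatMap f (allFin n)

  unit-if : ∀ b p → UnitCoeffs p → UnitCoeffs (if b then p else zeroP)
  unit-if true p unit = unit
  unit-if false p unit = []

  coeff-absent : ∀ p m → ¬ (m ∈ₘ p) → coeff p m ≈ 0#
  coeff-absent [] m _ = refl
  coeff-absent ((x , m′) ∷ p) m m∉p with ≡-dec _≟_ m′ m
  ... | yes e = ⊥-elim (m∉p (here e))
  ... | no _ = coeff-absent p m (λ w → m∉p (there w))

  coeff-present : Idempotent → ∀ p m → UnitCoeffs p → m ∈ₘ p → coeff p m ≈ 1#
  coeff-present idem ((x , m′) ∷ p) m (x≈1 ∷ unit) w with ≡-dec _≟_ m′ m
  ... | no ne = coeff-present idem p m unit (tail ne w)
    where
    tail : ¬ (m′ ≡ m) → m ∈ₘ ((x , m′) ∷ p) → m ∈ₘ p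
    tail ne (here e) = ⊥-elim (ne e)
    tail ne (there w) = w
  ... | yes _ with any? (λ t → ≡-dec _≟_ (proj₂ t) m) p
  ...   | yes w′ = trans (+-cong x≈1 (coeff-present idem p m unit w′)) (idem 1#)
  ...   | no w′ = trans (+-cong x≈1 (coeff-absent p m w′)) (+-identityʳ 1#)

  coeff-≈ : Idempotent → ∀ p q m → UnitCoeffs p → UnitCoeffs q →
            (m ∈ₘ p → m ∈ₘ q) → (m ∈ₘ q → m ∈ₘ p) → coeff p m ≈ coeff q m
  coeff-≈ idem p q m unitp unitq p⊆q q⊆p with any? (λ t → ≡-dec _≟_ (proj₂ t) m) p
  ... | yes w = trans (coeff-present idem p m unitp w) (sym (coeff-present idem q m unitq (p⊆q w)))
  ... | no w = trans (coeff-absent p m w) (sym (coeff-absent q m (λ w′ → w (q⊆p w′))))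

  ∈ₘ-starTerm⁺ : ∀ s c μ u q k j {m} → j < suc k → s + μ + j * c ≡ k → m ∈ₘ (u ⊗P powP q j) →
                 m ∈ₘ starTerm s c μ u q k
  ∈ₘ-starTerm⁺ s c μ u q k j j≤k eq w =
    concatMap⁺ _ (lose (∈-upTo⁺ j≤k) (∈ₘ-ifDec⁺ ((s + μ + j * c) ≟ k) _ eq w))

  ∈ₘ-starTerm⁻ : ∀ s c μ u q k {m} → m ∈ₘ starTerm s c μ u q k →
                 Σ ℕ λ j → s + μ + j * c ≡ k × m ∈ₘ (u ⊗P powP q j)
  ∈ₘ-starTerm⁻ s c μ u q k w with find (concatMap⁻ _ {xs = upTo (suc k)} w)
  ... | j , _ , w′ with ∈ₘ-ifDec⁻ ((s + μ + j * c) ≟ k) _ w′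
  ...   | eq , w″ = j , eq , w″

  unit-starTerm : ∀ s c μ u q k → UnitCoeffs u → UnitCoeffs q → UnitCoeffs (starTerm s c μ u q k)
  unit-starTerm s c μ u q k unitu unitq = unit-concatMap _ (upTo (suc k))
    (λ j → unit-if ⌊ (s + μ + j * c) ≟ k ⌋ _ (unit-⊗ u (powP q j) unitu (unit-powP q j unitq)))

  ∈ₘ-Pcoef⁺ : ∀ d P k {m} (k<d : k < d) → m ∈ₘ P (fromℕ< k<d) → m ∈ₘ Pcoef d P k
  ∈ₘ-Pcoef⁺ d P k k<d w with k <? d
  ... | yes k<d′ = subst (λ k<d → _ ∈ₘ P (fromℕ< k<d)) (<-irrelevant k<d k<d′) w
  ... | no k≮d = ⊥-elim (k≮d k<d)

  ∈ₘ-Pcoef⁻ : ∀ d P k {m} → m ∈ₘ Pcoef d P k → Σ (k < d) λ k<d → m ∈ₘ P (fromℕ< k<d)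
  ∈ₘ-Pcoef⁻ d P k w with k <? d
  ... | yes k<d = k<d , w

  unit-Pcoef : ∀ d P k → (∀ i → UnitCoeffs (P i)) → UnitCoeffs (Pcoef d P k)
  unit-Pcoef d P k unit with k <? d
  ... | yes k<d = unit (fromℕ< k<d)
  ... | no _ = unit-zero

module WalkPolynomials {a ℓ} (K : CommutativeSemiring a ℓ) (N : ℕ) where
  open ExponentVectors
  open Walks N
  open Support K N
  open WithK.Polys K N
  open import Data.Nat using (zero; suc; z≤n; s≤s)
  open import Data.Bool using (Bool; true; if_then_else_)
  open import Data.Bool.Properties using () renaming (_≟_ to _≟ᵇ_)
  open import Data.Fin using (Fin; toℕ; fromℕ<)
  open import Data.Fin.Properties using (toℕ<n; toℕ-fromℕ<; all?) renaming (_≟_ to _≟ᵛ_)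
  open import Data.List using (List; []; _∷_; length)
  open import Data.List.Relation.Unary.Any using (here; there)
  open import Data.List.Membership.Propositional using (_∈_)
  open import Data.List.Membership.DecPropositional (_≟ᵛ_ {N}) using (_∈?_)
  open import Data.Sum using (_⊎_; inj₁; inj₂)
  open import Relation.Nullary using (Dec)
  open import Relation.Nullary.Decidable using (⌊_⌋; _→-dec_)
  open import Relation.Binary.PropositionalEquality

  -- the linear form ⊕_x v_x · f x, for a family v of variables indexed by vertices;
  -- with v = A_i· it appends one step to walks, with v = c it chooses the start vertex
  linear : (Vertex → Fin (nVars N)) → (Vertex → Poly) → Poly
  linear v f = sumFin N (λ x → var (v x) ⊗P f x)

  ∈ₘ-linear⁺ : ∀ v f x {m} → m ∈ₘ f x → (unitMono {N} (v x) +ᵥ m) ∈ₘ linear v f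
  ∈ₘ-linear⁺ v f x w = ∈ₘ-sumFin⁺ N _ x (∈ₘ-⊗⁺ (var (v x)) (f x) (∈ₘ-var⁺ (v x)) w)

  ∈ₘ-linear⁻ : ∀ v f {m} → m ∈ₘ linear v f →
               Σ Vertex λ x → Σ MonoN λ m′ → m′ ∈ₘ f x × m ≡ unitMono {N} (v x) +ᵥ m′
  ∈ₘ-linear⁻ v f w with ∈ₘ-sumFin⁻ N _ w
  ... | x , w′ with ∈ₘ-⊗⁻ (var (v x)) (f x) w′
  ...   | m₁ , m′ , w₁ , w₂ , refl with ∈ₘ-var⁻ (v x) w₁
  ...     | refl = x , m′ , w₂ , refl

  unit-linear : ∀ v f → (∀ x → UnitCoeffs (f x)) → UnitCoeffs (linear v f)
  unit-linear v f unit = unit-sumFin N _ (λ x → unit-⊗ (var (v x)) (f x) (unit-var (v x)) (unit x))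

  ∈ₘ-Apowb⁻ : ∀ k i {m} → m ∈ₘ Apowb k i → Σ (List Vertex) λ xs → length xs ≡ k × m ≡ walkMono i xs
  ∈ₘ-Apowb⁻ zero i w = [] , refl , ∈ₘ-var⁻ (bVar i) w
  ∈ₘ-Apowb⁻ (suc k) i w with ∈ₘ-linear⁻ (AVar i) (Apowb k) w
  ... | x , m′ , w′ , refl with ∈ₘ-Apowb⁻ k x w′
  ...   | xs , len , refl = x ∷ xs , cong suc len , refl

  ∈ₘ-Apowb⁺ : ∀ i xs → walkMono i xs ∈ₘ Apowb (length xs) i
  ∈ₘ-Apowb⁺ i [] = ∈ₘ-var⁺ (bVar i)
  ∈ₘ-Apowb⁺ i (x ∷ xs) = ∈ₘ-linear⁺ (AVar i) (Apowb (length xs)) x (∈ₘ-Apowb⁺ x xs)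

  unit-Apowb : ∀ k i → UnitCoeffs (Apowb k i)
  unit-Apowb zero i = unit-var _
  unit-Apowb (suc k) i = unit-linear (AVar i) (Apowb k) (unit-Apowb k)

  ∈ₘ-S⁻ : ∀ k {m} → m ∈ₘ S k →
          Σ Vertex λ s → Σ (List Vertex) λ xs → length xs ≡ k × m ≡ monoC s +ᵥ walkMono s xs
  ∈ₘ-S⁻ k w with ∈ₘ-linear⁻ cVar (Apowb k) w
  ... | s , m′ , w′ , refl with ∈ₘ-Apowb⁻ k s w′
  ...   | xs , len , refl = s , xs , len , refl

  ∈ₘ-S⁺ : ∀ s xs → (monoC s +ᵥ walkMono s xs) ∈ₘ S (length xs)
  ∈ₘ-S⁺ s xs = ∈ₘ-linear⁺ cVar (Apowb (length xs)) s (∈ₘ-Apowb⁺ s xs)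

  unit-S : ∀ k → UnitCoeffs (S k)
  unit-S k = unit-linear cVar (Apowb k) (λ s → unit-Apowb k s)

  paths : ℕ → Vertex → Vertex → Poly
  paths zero i j = if ⌊ i ≟ᵛ j ⌋ then oneP else zeroP
  paths (suc k) i j = linear (AVar i) (λ x → paths k x j)

  ∈ₘ-paths⁻ : ∀ k i j {m} → m ∈ₘ paths k i j →
              Σ (List Vertex) λ xs → length xs ≡ k × endpoint i xs ≡ j × m ≡ pathMono i xs
  ∈ₘ-paths⁻ zero i j w with ∈ₘ-ifDec⁻ (i ≟ᵛ j) oneP w
  ... | i≡j , w′ = [] , refl , i≡j , ∈ₘ-one⁻ w′
  ∈ₘ-paths⁻ (suc k) i j w with ∈ₘ-linear⁻ (AVar i) (λ x → paths k x j) w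
  ... | x , m′ , w′ , refl with ∈ₘ-paths⁻ k x j w′
  ...   | xs , len , end , refl = x ∷ xs , cong suc len , end , refl

  ∈ₘ-paths⁺ : ∀ i xs → pathMono i xs ∈ₘ paths (length xs) i (endpoint i xs)
  ∈ₘ-paths⁺ i [] = ∈ₘ-ifDec⁺ (i ≟ᵛ i) oneP refl ∈ₘ-one⁺
  ∈ₘ-paths⁺ i (x ∷ xs) = ∈ₘ-linear⁺ (AVar i) (λ y → paths (length xs) y (endpoint x xs)) x (∈ₘ-paths⁺ x xs)

  unit-paths : ∀ k i j → UnitCoeffs (paths k i j)
  unit-paths zero i j = unit-if _ oneP unit-one
  unit-paths (suc k) i j = unit-linear (AVar i) (λ x → paths k x j) (λ x → unit-paths k x j)

  module ForVertexSet (U : Vertex → Bool) where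

    covers? : (L : List Vertex) → Dec (∀ y → U y ≡ true → y ∈ L)
    covers? L = all? (λ y → (U y ≟ᵇ true) →-dec (y ∈? L))

    -- walks of length k from i which, together with the vertices in seen, visit all of U
    coveringWalks : ℕ → Vertex → List Vertex → Poly
    coveringWalks zero i seen = if ⌊ covers? (i ∷ seen) ⌋ then var (bVar i) else zeroP
    coveringWalks (suc k) i seen = linear (AVar i) (λ x → coveringWalks k x (i ∷ seen))

    ∈ₘ-coveringWalks⁻ : ∀ k i seen {m} → m ∈ₘ coveringWalks k i seen →
      Σ (List Vertex) λ xs → length xs ≡ k × (∀ y → U y ≡ true → y ∈ seen ⊎ y ∈ i ∷ xs) × m ≡ walkMono i xs
    ∈ₘ-coveringWalks⁻ zero i seen w with ∈ₘ-ifDec⁻ (covers? (i ∷ seen)) _ w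
    ... | covers , w′ = [] , refl , covers′ , ∈ₘ-var⁻ (bVar i) w′
      where
      covers′ : ∀ y → U y ≡ true → y ∈ seen ⊎ y ∈ i ∷ []
      covers′ y u with covers y u
      ... | here e = inj₂ (here e)
      ... | there q = inj₁ q
    ∈ₘ-coveringWalks⁻ (suc k) i seen w with ∈ₘ-linear⁻ (AVar i) (λ x → coveringWalks k x (i ∷ seen)) w
    ... | x , m′ , w′ , refl with ∈ₘ-coveringWalks⁻ k x (i ∷ seen) w′
    ...   | xs , len , covers , refl = x ∷ xs , cong suc len , covers′ , refl
      where
      covers′ : ∀ y → U y ≡ true → y ∈ seen ⊎ y ∈ i ∷ x ∷ xs
      covers′ y u with covers y u
      ... | inj₁ (here e) = inj₂ (here e)
      ... | inj₁ (there q) = inj₁ q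
      ... | inj₂ q = inj₂ (there q)

    ∈ₘ-coveringWalks⁺ : ∀ i xs seen → (∀ y → U y ≡ true → y ∈ seen ⊎ y ∈ i ∷ xs) →
                        walkMono i xs ∈ₘ coveringWalks (length xs) i seen
    ∈ₘ-coveringWalks⁺ i [] seen covers = ∈ₘ-ifDec⁺ (covers? (i ∷ seen)) _ covers′ (∈ₘ-var⁺ (bVar i))
      where
      covers′ : ∀ y → U y ≡ true → y ∈ i ∷ seen
      covers′ y u with covers y u
      ... | inj₁ q = there q
      ... | inj₂ (here e) = here e
    ∈ₘ-coveringWalks⁺ i (x ∷ xs) seen covers =
      ∈ₘ-linear⁺ (AVar i) (λ y → coveringWalks (length xs) y (i ∷ seen)) x
        (∈ₘ-coveringWalks⁺ x xs (i ∷ seen) covers′)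
      where
      covers′ : ∀ y → U y ≡ true → y ∈ i ∷ seen ⊎ y ∈ x ∷ xs
      covers′ y u with covers y u
      ... | inj₁ q = inj₁ (there q)
      ... | inj₂ (here e) = inj₁ (here e)
      ... | inj₂ (there q) = inj₂ q

    unit-coveringWalks : ∀ k i seen → UnitCoeffs (coveringWalks k i seen)
    unit-coveringWalks zero i seen = unit-if _ _ (unit-var _)
    unit-coveringWalks (suc k) i seen =
      unit-linear (AVar i) (λ x → coveringWalks k x (i ∷ seen)) (λ x → unit-coveringWalks k x (i ∷ seen))

    uPoly : ℕ → Poly
    uPoly n = linear cVar (λ s → coveringWalks n s [])

    unit-uPoly : ∀ n → UnitCoeffs (uPoly n)
    unit-uPoly n = unit-linear cVar (λ s → coveringWalks n s []) (λ s → unit-coveringWalks n s [])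

    ∈ₘ-uPoly⁻ : ∀ n {m} → m ∈ₘ uPoly n → Σ Vertex λ s → Σ (List Vertex) λ xs → length xs ≡ n ×
                (∀ y → U y ≡ true → y ∈ s ∷ xs) × m ≡ monoC s +ᵥ walkMono s xs
    ∈ₘ-uPoly⁻ n w with ∈ₘ-linear⁻ cVar (λ s → coveringWalks n s []) w
    ... | s , m′ , w′ , refl with ∈ₘ-coveringWalks⁻ n s [] w′
    ...   | xs , len , covers , refl = s , xs , len , covers′ , refl
      where
      covers′ : ∀ y → U y ≡ true → y ∈ s ∷ xs
      covers′ y u with covers y u
      ... | inj₂ q = q

    ∈ₘ-uPoly⁺ : ∀ s xs → (∀ y → U y ≡ true → y ∈ s ∷ xs) → (monoC s +ᵥ walkMono s xs) ∈ₘ uPoly (length xs)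
    ∈ₘ-uPoly⁺ s xs covers =
      ∈ₘ-linear⁺ cVar (λ s → coveringWalks (length xs) s []) s
        (∈ₘ-coveringWalks⁺ s xs [] (λ y u → inj₂ (covers y u)))

    cyclesAt : ℕ → Poly
    cyclesAt ℓ = sumFin N (λ v → if U v then paths ℓ v v else zeroP)

    unit-cyclesAt : ∀ ℓ → UnitCoeffs (cyclesAt ℓ)
    unit-cyclesAt ℓ = unit-sumFin N _ (λ v → unit-if (U v) _ (unit-paths ℓ v v))

    ∈ₘ-cyclesAt⁻ : ∀ ℓ {m} → m ∈ₘ cyclesAt ℓ → Σ Vertex λ v → Σ (List Vertex) λ cs →
                   U v ≡ true × length cs ≡ ℓ × endpoint v cs ≡ v × m ≡ pathMono v cs
    ∈ₘ-cyclesAt⁻ ℓ w with ∈ₘ-sumFin⁻ N _ w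
    ... | v , w′ with ∈ₘ-if⁻ (U v) _ w′
    ...   | v∈U , w″ with ∈ₘ-paths⁻ ℓ v v w″
    ...     | cs , len , end , m≡ = v , cs , v∈U , len , end , m≡

    ∈ₘ-cyclesAt⁺ : ∀ v cs → U v ≡ true → endpoint v cs ≡ v → pathMono v cs ∈ₘ cyclesAt (length cs)
    ∈ₘ-cyclesAt⁺ v cs v∈U end = ∈ₘ-sumFin⁺ N _ v
      (∈ₘ-if⁺ (U v) _ v∈U (subst (λ z → pathMono v cs ∈ₘ paths (length cs) v z) end (∈ₘ-paths⁺ v cs)))

    power-cycles⁻ : ∀ ℓ k {m} → 1 ≤ ℓ → ℓ ≤ N → Power (cyclesAt ℓ) k m →
      Σ (List Cycle) λ cl → m ≡ cyclesMono cl × length cl ≡ k ×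
        (∀ x → x ∈ cl → cycleLength x ≡ ℓ) × (∀ x → x ∈ cl → U (base x) ≡ true)
    power-cycles⁻ ℓ .zero lo hi power-zero = [] , refl , refl , (λ _ ()) , (λ _ ())
    power-cycles⁻ ℓ (suc k) lo hi (power-suc w ws) with ∈ₘ-cyclesAt⁻ ℓ w | power-cycles⁻ ℓ k lo hi ws
    ... | v , cs , v∈U , len , end , refl | cl , refl , count , lengths , bases =
      mkCycle v cs end (subst (1 ≤_) (sym len) lo) (subst (_≤ N) (sym len) hi) ∷ cl , refl , cong suc count ,
        (λ { x (here refl) → len ; x (there q) → lengths x q }) ,
        (λ { x (here refl) → v∈U ; x (there q) → bases x q })

    power-cycles⁺ : ∀ ℓ cl → (∀ x → x ∈ cl → cycleLength x ≡ ℓ) → (∀ x → x ∈ cl → U (base x) ≡ true) →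
                    Power (cyclesAt ℓ) (length cl) (cyclesMono cl)
    power-cycles⁺ ℓ [] _ _ = power-zero
    power-cycles⁺ ℓ (x ∷ cl) lengths bases =
      power-suc (subst (λ z → cycleMono x ∈ₘ cyclesAt z) (lengths x (here refl))
                       (∈ₘ-cyclesAt⁺ (base x) (vertices x) (bases x (here refl)) (closed x)))
                (power-cycles⁺ ℓ cl (λ y q → lengths y (there q)) (λ y q → bases y (there q)))

    -- q_U = ⊕_{ℓ=1}^{N} (cyclesAt ℓ)^(e ℓ) where e ℓ · ℓ = c: it lists exactly the
    -- families of e ℓ cycles of a common length ℓ (total length c) based in U
    module Period (c : ℕ) (e : ℕ → ℕ) (e-div : ∀ ℓ → 1 ≤ ℓ → ℓ ≤ N → e ℓ * ℓ ≡ c) where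
      lengthOf : Fin N → ℕ
      lengthOf i = suc (toℕ i)

      qPoly : Poly
      qPoly = sumFin N (λ i → powP (cyclesAt (lengthOf i)) (e (lengthOf i)))

      unit-qPoly : UnitCoeffs qPoly
      unit-qPoly = unit-sumFin N _ (λ i → unit-powP (cyclesAt (lengthOf i)) (e (lengthOf i)) (unit-cyclesAt (lengthOf i)))

      ∈ₘ-qPoly⁻ : ∀ {m} → m ∈ₘ qPoly → Σ (List Cycle) λ cl → m ≡ cyclesMono cl × totalLength cl ≡ c ×
                  (∀ x → x ∈ cl → U (base x) ≡ true)
      ∈ₘ-qPoly⁻ w with ∈ₘ-sumFin⁻ N _ w
      ... | i , w′ with power-cycles⁻ (lengthOf i) (e (lengthOf i)) (s≤s z≤n) (toℕ<n i)
                          (∈ₘ-powP⁻ (cyclesAt (lengthOf i)) (e (lengthOf i)) w′)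
      ...   | cl , m≡ , count , lengths , bases = cl , m≡ ,
              trans (totalLength-uniform (lengthOf i) cl lengths)
                    (trans (cong (_* lengthOf i) count) (e-div (lengthOf i) (s≤s z≤n) (toℕ<n i))) ,
              bases

      ∈ₘ-qPoly⁺ : ∀ ℓ → 1 ≤ ℓ → ℓ ≤ N → ∀ cl → length cl ≡ e ℓ → (∀ x → x ∈ cl → cycleLength x ≡ ℓ) →
                  (∀ x → x ∈ cl → U (base x) ≡ true) → cyclesMono cl ∈ₘ qPoly
      ∈ₘ-qPoly⁺ (suc ℓ) _ ℓ≤N cl count lengths bases = ∈ₘ-sumFin⁺ N _ i
        (subst (λ z → cyclesMono cl ∈ₘ powP (cyclesAt z) (e z)) (sym lengthOf-i)
          (∈ₘ-powP⁺ _ _ (subst (λ z → Power (cyclesAt (suc ℓ)) z (cyclesMono cl)) count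
            (power-cycles⁺ (suc ℓ) cl lengths bases))))
        where
        i : Fin N
        i = fromℕ< ℓ≤N
        lengthOf-i : lengthOf i ≡ suc ℓ
        lengthOf-i = cong suc (toℕ-fromℕ< ℓ≤N)

module Construction {a ℓ} (K : CommutativeSemiring a ℓ) (idem : WithK.Idempotent K)
                    (N : ℕ) (N≥1 : 1 ≤ N) where
  open ExponentVectors
  open Walks N
  open Counting
  open Sizes N
  open Support K N
  open WalkPolynomials K N
  open WithK.Polys K N
  open import Data.Nat using (zero; suc; _+_; _∸_; _<_; _<?_; s≤s; NonZero; >-nonZero)
  open import Data.Nat.Properties
  open import Algebra.Properties.CommutativeSemigroup +-commutativeSemigroup
    using () renaming (x∙yz≈y∙xz to +-swap)
  open import Data.Nat.DivMod using (_/_; _%_; m/n*n≡m; m≡m%n+[m/n]*n; m%n<n)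
  open import Data.Nat.Divisibility using (∣-trans; m∣m*n; m≤n⇒m!∣n!)
  open import Data.Bool using (Bool; true)
  open import Data.Bool.Properties using (T-≡)
  open import Data.Fin using (Fin; toℕ; fromℕ<; combine; remQuot)
  open import Data.Fin.Properties using (remQuot-combine; toℕ-fromℕ<; toℕ<n) renaming (_≟_ to _≟ᵛ_)
  open import Data.Vec using (lookup)
  open import Data.List using (List; _∷_; length)
  open import Data.List.Relation.Unary.Any using (any?)
  open import Data.List.Membership.Propositional using (_∈_)
  open import Data.List.Membership.DecPropositional (_≟ᵛ_ {N}) using (_∈?_)
  open import Data.Product using (proj₁; proj₂)
  open import Data.Sum using (inj₁; inj₂)
  open import Data.Empty using (⊥-elim)
  open import Function.Bundles using (Equivalence)
  open import Relation.Nullary using (¬_; Dec; yes; no)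
  open import Relation.Nullary.Decidable using (⌊_⌋; isYes≗does; dec-true; toWitness)
  open import Data.Vec.Properties using (≡-dec)
  open import Relation.Binary.PropositionalEquality
  open CommutativeSemiring K using (_≈_; 0#)

  -- e ℓ = N!/ℓ cycles of length ℓ make up one period c = N!
  multiplicity : ℕ → ℕ
  multiplicity zero = 0
  multiplicity (suc ℓ) = N ! / suc ℓ

  multiplicity-div : ∀ ℓ → 1 ≤ ℓ → ℓ ≤ N → multiplicity ℓ * ℓ ≡ c
  multiplicity-div (suc ℓ) _ ℓ<N = m/n*n≡m (∣-trans (m∣m*n (ℓ !)) (m≤n⇒m!∣n! ℓ<N))

  c≥1 : 1 ≤ c
  c≥1 = 1≤n! N

  uPoly : (Vertex → Bool) → ℕ → Poly
  uPoly U = ForVertexSet.uPoly U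

  qPoly : (Vertex → Bool) → Poly
  qPoly U = ForVertexSet.Period.qPoly U c multiplicity multiplicity-div

  VertexSet : (Vertex → Bool) → Vertex → List Vertex → Set
  VertexSet U s xs = (∀ y → y ∈ s ∷ xs → U y ≡ true) × (∀ y → U y ≡ true → y ∈ s ∷ xs)

  longEnough : ∀ r j (xs : List Vertex) → length xs ≡ T + r + j * c → N * c * N + suc N * suc N ≤ length xs
  longEnough r j xs len =
    ≤-trans threshold (≤-trans (≤-trans (m≤m+n T r) (m≤m+n (T + r) (j * c))) (≤-reflexive (sym len)))

  pumpDown : ∀ U r j s xs → VertexSet U s xs → length xs ≡ T + r + j * c →
             (monoC s +ᵥ walkMono s xs) ∈ₘ (uPoly U (T + r) ⊗P powP (qPoly U) j)
  -- one period: pump down the rest of the walk and multiply by the pumped cycles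
  pumpDownStep : ∀ U r j s xs → VertexSet U s xs → length xs ≡ T + r + suc j * c →
                 PumpStep c multiplicity s xs →
                 (monoC s +ᵥ walkMono s xs) ∈ₘ (uPoly U (T + r) ⊗P powP (qPoly U) (suc j))

  pumpDown U r zero s xs (_ , covers) len =
    subst (_∈ₘ (uPoly U (T + r) ⊗P oneP)) (+ᵥ-identityʳ _)
      (∈ₘ-⊗⁺ (uPoly U (T + r)) oneP
        (subst (λ n → (monoC s +ᵥ walkMono s xs) ∈ₘ uPoly U n) (trans len (+-identityʳ _))
          (ForVertexSet.∈ₘ-uPoly⁺ U s xs covers))
        ∈ₘ-one⁺)
  pumpDown U r (suc j) s xs vertexSet len =
    pumpDownStep U r j s xs vertexSet len
      (pumpStep c multiplicity N≥1 c≥1 multiplicity-div s xs (longEnough r (suc j) xs len))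

  pumpDownStep U r j s xs (inU , covers) len
               (mkPumpStep ys ℓ pumped lenys monoys keeps within ℓ-pos ℓ≤N count uniform bases∈)
    with ∈ₘ-⊗⁻ (uPoly U (T + r)) (powP (qPoly U) j)
           (pumpDown U r j s ys ((λ y q → inU y (within y q)) , (λ y u → keeps y (covers y u)))
             (+-cancelˡ-≡ c _ _ (trans (sym lenys) (trans len (+-swap (T + r) c (j * c))))))
  ... | m₁ , m₂ , w₁ , w₂ , m≡ =
    subst (_∈ₘ (uPoly U (T + r) ⊗P powP (qPoly U) (suc j))) (sym factorisation)
      (∈ₘ-⊗⁺ (uPoly U (T + r)) (powP (qPoly U) (suc j)) w₁
        (∈ₘ-⊗⁺ (qPoly U) (powP (qPoly U) j)
          (ForVertexSet.Period.∈ₘ-qPoly⁺ U c multiplicity multiplicity-div ℓ ℓ-pos ℓ≤N pumped count uniform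
            (λ x q → inU _ (bases∈ x q)))
          w₂))
    where
    factorisation : monoC s +ᵥ walkMono s xs ≡ m₁ +ᵥ (cyclesMono pumped +ᵥ m₂)
    factorisation = begin
      monoC s +ᵥ walkMono s xs                         ≡⟨ cong (monoC s +ᵥ_) monoys ⟩
      monoC s +ᵥ (cyclesMono pumped +ᵥ walkMono s ys)  ≡⟨ +ᵥ-swap _ _ _ ⟩
      cyclesMono pumped +ᵥ (monoC s +ᵥ walkMono s ys)  ≡⟨ cong (cyclesMono pumped +ᵥ_) m≡ ⟩
      cyclesMono pumped +ᵥ (m₁ +ᵥ m₂)                  ≡⟨ +ᵥ-swap _ _ _ ⟩
      m₁ +ᵥ (cyclesMono pumped +ᵥ m₂)                  ∎
      where open ≡-Reasoning

  pumpUp : ∀ U j {m} → Power (qPoly U) j m → ∀ s xs → (∀ y → U y ≡ true → y ∈ s ∷ xs) →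
           Σ (List Vertex) λ ys → length ys ≡ j * c + length xs × walkMono s ys ≡ m +ᵥ walkMono s xs ×
             (∀ y → y ∈ s ∷ xs → y ∈ s ∷ ys)
  pumpUp U .zero power-zero s xs covers = xs , refl , sym (+ᵥ-identityˡ _) , (λ _ q → q)
  pumpUp U (suc j) (power-suc w ws) s xs covers with pumpUp U j ws s xs covers
  ... | ys , lenys , monoys , keeps with ForVertexSet.Period.∈ₘ-qPoly⁻ U c multiplicity multiplicity-div w
  ...   | cl , refl , total , bases with insertCycles s ys cl (λ x q → keeps _ (covers _ (bases x q)))
  ...     | mkCyclesInsertion zs lenzs monozs keeps′ _ =
    zs , trans lenzs (trans (cong₂ _+_ total lenys) (sym (+-assoc c (j * c) _))) ,
    trans monozs (trans (cong (cyclesMono cl +ᵥ_) monoys) (sym (+ᵥ-assoc _ _ _))) ,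
    (λ y q → keeps′ y (keeps y q))

  -- The witnesses: ρ = 2^N·N! periodic terms, labelled by a vertex set U and an offset μ < c.
  ρ : ℕ
  ρ = 2 ^ N * c

  offset : Fin ρ → Fin c
  offset i = proj₂ (remQuot {2 ^ N} c i)

  setOf : Fin ρ → Vertex → Bool
  setOf i = subsetOf (proj₁ (remQuot {2 ^ N} c i))

  uᵢ : Fin ρ → Poly
  uᵢ i = uPoly (setOf i) (T + toℕ (offset i))

  qᵢ : Fin ρ → Poly
  qᵢ i = qPoly (setOf i)

  Pᵢ : Fin T → Poly
  Pᵢ i = S (toℕ i)

  periodic : ℕ → Poly
  periodic k = sumFin ρ (λ i → starTerm T c (toℕ (offset i)) (uᵢ i) (qᵢ i) k)

  instance
    c≢0 : NonZero c
    c≢0 = >-nonZero c≥1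

  label : ∀ s xs (r : Fin c) → Σ (Fin ρ) λ i → offset i ≡ r × VertexSet (setOf i) s xs
  label s xs r = combine code r , cong proj₂ decode , inSet , covers
    where
    visited : Vertex → Bool
    visited y = ⌊ y ∈? s ∷ xs ⌋
    code : Fin (2 ^ N)
    code = encode visited
    decode : remQuot {2 ^ N} c (combine code r) ≡ (code , r)
    decode = remQuot-combine {2 ^ N} {c} code r
    setOf≡ : ∀ y → setOf (combine code r) y ≡ visited y
    setOf≡ y = trans (cong (λ z → subsetOf (proj₁ z) y) decode) (subsetOf-encode visited y)
    inSet : ∀ y → y ∈ s ∷ xs → setOf (combine code r) y ≡ true
    inSet y q = trans (setOf≡ y) (trans (isYes≗does (y ∈? s ∷ xs)) (dec-true (y ∈? s ∷ xs) q))
    covers : ∀ y → setOf (combine code r) y ≡ true → y ∈ s ∷ xs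
    covers y u = toWitness (Equivalence.from T-≡ (trans (sym (setOf≡ y)) u))

  -- the periodic part lists only monomials of S_N, and only in degrees k ≥ T ...
  periodic⊆S : ∀ k {m} → m ∈ₘ periodic k → T ≤ k × m ∈ₘ S k
  periodic⊆S k w with ∈ₘ-sumFin⁻ ρ _ w
  ... | i , w₁ with ∈ₘ-starTerm⁻ T c (toℕ (offset i)) (uᵢ i) (qᵢ i) k w₁
  ...   | j , k≡ , w₂ with ∈ₘ-⊗⁻ (uᵢ i) (powP (qᵢ i) j) w₂
  ...     | m₁ , m₂ , w₃ , w₄ , refl with ForVertexSet.∈ₘ-uPoly⁻ (setOf i) (T + toℕ (offset i)) w₃
  ...       | s , xs , len , covers , refl with pumpUp (setOf i) j (∈ₘ-powP⁻ (qᵢ i) j w₄) s xs covers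
  ...         | ys , lenys , monoys , _ =
    ≤-trans (≤-trans (m≤m+n T _) (m≤m+n (T + toℕ (offset i)) (j * c))) (≤-reflexive k≡) ,
    subst (_∈ₘ S k) monomial (subst (λ n → (monoC s +ᵥ walkMono s ys) ∈ₘ S n) length-ys (∈ₘ-S⁺ s ys))
    where
    length-ys : length ys ≡ k
    length-ys = trans lenys (trans (cong (j * c +_) len) (trans (+-comm (j * c) _) k≡))
    monomial : monoC s +ᵥ walkMono s ys ≡ (monoC s +ᵥ walkMono s xs) +ᵥ m₂
    monomial = begin
      monoC s +ᵥ walkMono s ys          ≡⟨ cong (monoC s +ᵥ_) monoys ⟩
      monoC s +ᵥ (m₂ +ᵥ walkMono s xs)  ≡⟨ cong (monoC s +ᵥ_) (+ᵥ-comm m₂ _) ⟩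
      monoC s +ᵥ (walkMono s xs +ᵥ m₂)  ≡⟨ sym (+ᵥ-assoc _ _ _) ⟩
      (monoC s +ᵥ walkMono s xs) +ᵥ m₂  ∎
      where open ≡-Reasoning

  -- ... and in degree k ≥ T it lists all of them: the walk of a monomial of S k is
  -- pumped down in the term labelled by its vertex set and the offset (k - T) mod c
  S⊆periodic : ∀ k {m} → T ≤ k → m ∈ₘ S k → m ∈ₘ periodic k
  S⊆periodic k T≤k w with ∈ₘ-S⁻ k w
  ... | s , xs , len , refl with label s xs (fromℕ< (m%n<n (k ∸ T) c))
  ...   | i , offset≡ , vertexSet =
    ∈ₘ-sumFin⁺ ρ _ i (∈ₘ-starTerm⁺ T c (toℕ (offset i)) (uᵢ i) (qᵢ i) k j j<1+k k≡
      (pumpDown (setOf i) (toℕ (offset i)) j s xs vertexSet (trans len (sym k≡))))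
    where
    r = (k ∸ T) % c
    j = (k ∸ T) / c
    k≡ : T + toℕ (offset i) + j * c ≡ k
    k≡ = begin
      T + toℕ (offset i) + j * c  ≡⟨ cong (λ z → T + z + j * c) (trans (cong toℕ offset≡) (toℕ-fromℕ< _)) ⟩
      T + r + j * c               ≡⟨ +-assoc T r (j * c) ⟩
      T + (r + j * c)             ≡⟨ cong (T +_) (sym (m≡m%n+[m/n]*n (k ∸ T) c)) ⟩
      T + (k ∸ T)                 ≡⟨ m+[n∸m]≡n T≤k ⟩
      k                           ∎
      where open ≡-Reasoning
    j<1+k : j < suc k
    j<1+k = s≤s (≤-trans (m≤m*n j c) (≤-trans (m≤n+m (j * c) r)
              (≤-trans (≤-reflexive (sym (m≡m%n+[m/n]*n (k ∸ T) c))) (m∸n≤m k T))))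

  unit-rhs : ∀ k → UnitCoeffs (rhs κ c ρ offset uᵢ qᵢ Pᵢ k)
  unit-rhs k = unit-⊕ (unit-Pcoef T Pᵢ k (λ i → unit-S (toℕ i)))
    (unit-sumFin ρ _ (λ i → unit-starTerm T c (toℕ (offset i)) (uᵢ i) (qᵢ i) k
      (ForVertexSet.unit-uPoly (setOf i) (T + toℕ (offset i)))
      (ForVertexSet.Period.unit-qPoly (setOf i) c multiplicity multiplicity-div)))

  same-support : ∀ k {m} → (m ∈ₘ S k → m ∈ₘ rhs κ c ρ offset uᵢ qᵢ Pᵢ k) × (m ∈ₘ rhs κ c ρ offset uᵢ qᵢ Pᵢ k → m ∈ₘ S k)
  same-support k = S⊆rhs , rhs⊆S
    where
    S⊆rhs : ∀ {m} → m ∈ₘ S k → m ∈ₘ rhs κ c ρ offset uᵢ qᵢ Pᵢ k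
    S⊆rhs {m} w = byDegree (k <? T)
      where
      -- (a case split on k <? T itself would also rewrite the Pcoef inside the goal)
      byDegree : Dec (k < T) → m ∈ₘ rhs κ c ρ offset uᵢ qᵢ Pᵢ k
      byDegree (yes k<T) = ∈ₘ-⊕⁺ˡ (Pcoef T Pᵢ k) (periodic k)
        (∈ₘ-Pcoef⁺ T Pᵢ k k<T (subst (λ n → m ∈ₘ S n) (sym (toℕ-fromℕ< k<T)) w))
      byDegree (no k≮T) = ∈ₘ-⊕⁺ʳ (Pcoef T Pᵢ k) (periodic k) (S⊆periodic k (≮⇒≥ k≮T) w)
    rhs⊆S : ∀ {m} → m ∈ₘ rhs κ c ρ offset uᵢ qᵢ Pᵢ k → m ∈ₘ S k
    rhs⊆S w with ∈ₘ-⊕⁻ (Pcoef T Pᵢ k) (periodic k) w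
    ... | inj₁ w′ with ∈ₘ-Pcoef⁻ T Pᵢ k w′
    ...   | k<T , w″ = subst (λ n → _ ∈ₘ S n) (toℕ-fromℕ< k<T) w″
    rhs⊆S w | inj₂ w′ = proj₂ (periodic⊆S k w′)

  decomposition : ∀ k m → coeff (S k) m ≈ coeff (rhs κ c ρ offset uᵢ qᵢ Pᵢ k) m
  decomposition k m =
    coeff-≈ idem (S k) (rhs κ c ρ offset uᵢ qᵢ Pᵢ k) m (unit-S k) (unit-rhs k)
      (proj₁ (same-support k)) (proj₂ (same-support k))

  -- A polynomial whose listed monomials have all exponents ≤ D has at most
  -- (D+1)^(2N+N²) ≤ 2^(C·N!) monomials with nonzero coefficient.
  fewMonomials : ∀ p → (∀ m → m ∈ₘ p → ∀ x → lookup m x ≤ D) → AtMostMonos (2 ^ (C₀ * N !)) p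
  fewMonomials p bounded =
    boundedVecs (nVars N) D ,
    subst (_≤ 2 ^ (C₀ * N !)) (sym (length-boundedVecs (nVars N) D)) monomials≤ ,
    listed
    where
    listed : ∀ m → ¬ (coeff p m ≈ 0#) → m ∈ boundedVecs (nVars N) D
    listed m nonzero with any? (λ t → ≡-dec _≟_ (proj₂ t) m) p
    ... | yes w = ∈-boundedVecs (nVars N) D m (bounded m w)
    ... | no w = ⊥-elim (nonzero (coeff-absent p m w))

  walkExponents : ∀ s (xs : List Vertex) x → length xs ≤ T + c → lookup (monoC s +ᵥ walkMono s xs) x ≤ D
  walkExponents s xs x short =
    ≤-trans (termMono-bound s xs x) (≤-trans (s≤s (s≤s short)) (≤-reflexive (sym (+-comm (T + c) 2))))

  Pᵢ-few : ∀ i → AtMostMonos (2 ^ (C₀ * N !)) (Pᵢ i)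
  Pᵢ-few i = fewMonomials (Pᵢ i) bounded
    where
    bounded : ∀ m → m ∈ₘ Pᵢ i → ∀ x → lookup m x ≤ D
    bounded m w x with ∈ₘ-S⁻ (toℕ i) w
    ... | s , xs , len , refl =
      walkExponents s xs x (≤-trans (≤-reflexive len) (≤-trans (<⇒≤ (toℕ<n i)) (m≤m+n T c)))

  uᵢ-few : ∀ i → AtMostMonos (2 ^ (C₀ * N !)) (uᵢ i)
  uᵢ-few i = fewMonomials (uᵢ i) bounded
    where
    bounded : ∀ m → m ∈ₘ uᵢ i → ∀ x → lookup m x ≤ D
    bounded m w x with ForVertexSet.∈ₘ-uPoly⁻ (setOf i) (T + toℕ (offset i)) w
    ... | s , xs , len , _ , refl =
      walkExponents s xs x (≤-trans (≤-reflexive len) (+-monoʳ-≤ T (<⇒≤ (toℕ<n (offset i)))))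

  qᵢ-few : ∀ i → AtMostMonos (2 ^ (C₀ * N !)) (qᵢ i)
  qᵢ-few i = fewMonomials (qᵢ i) bounded
    where
    bounded : ∀ m → m ∈ₘ qᵢ i → ∀ x → lookup m x ≤ D
    bounded m w x with ForVertexSet.Period.∈ₘ-qPoly⁻ (setOf i) c multiplicity multiplicity-div w
    ... | cl , refl , total , _ =
      ≤-trans (cyclesMono-bound cl x) (≤-trans (≤-reflexive total) (≤-trans (m≤n+m c T) (m≤m+n (T + c) 2)))

-- For N ≥ 1 take κ₁ = N² + (N+1)², ρ = 2^N·N!, P the first κ₁·N!
-- coefficients of S_N, and the periodic terms of Construction; with C = C₀ = 512 the
-- bounds κ₁ ≤ C·N!, ρ ≤ 2^(C·N!) and the monomial counts ≤ 2^(C·N!) are those of Sizes.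
corollary2 : ∀ {a ℓ : Level} →
    Σ ℕ λ C →
    (K : CommutativeSemiring a ℓ) →
    WithK.Idempotent K → WithK.LinearlyOrdered K →
    WithK.Archimedean K → WithK.Cancellative K →
    (N : ℕ) → 1 ≤ N →
    Σ ℕ λ κ₁ → (κ₁ ≤ C * (N !)) ×
    (Σ ℕ λ ρ → (ρ ≤ 2 ^ (C * (N !))) ×
    (Σ (Fin ρ → Fin (N !)) λ μ →
    Σ (Fin ρ → WithK.Polys.Poly K N) λ u →
    Σ (Fin ρ → WithK.Polys.Poly K N) λ q →
    Σ (Fin (κ₁ * (N !)) → WithK.Polys.Poly K N) λ P →
      (∀ (k : ℕ) (m : Mono N) →
        CommutativeSemiring._≈_ K (WithK.Polys.coeff K N (WithK.Polys.S K N k) m)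
          (WithK.Polys.coeff K N (WithK.Polys.rhs K N κ₁ (N !) ρ μ u q P k) m)) ×
      (∀ i → WithK.Polys.AtMostMonos K N (2 ^ (C * (N !))) (P i)) ×
      (∀ i → WithK.Polys.AtMostMonos K N (2 ^ (C * (N !))) (u i)) ×
      (∀ i → WithK.Polys.AtMostMonos K N (2 ^ (C * (N !))) (q i))))
corollary2 = C₀ , λ K idempotent _ _ _ N N≥1 →
  let open Sizes N
      open Construction K idempotent N N≥1
  in
  κ , κ≤ , ρ , ρ≤ , offset , uᵢ , qᵢ , Pᵢ , decomposition , Pᵢ-few , uᵢ-few , qᵢ-few
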